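{- Let $K$ be a subgraph of a finite graph $G$, and let $\beta:C(G)\to C(K)$ be the map defined in the context. Then: (1) $\beta:C(G)\to C(K)$ is a degree preserving chain map; therefore (2) it induces a degree preserving homomorphism $\beta^*:H^i(G)\to H^i(K)$ for each $i$; (3) this correspondence is natural: if $L\subseteq K\subseteq G$ are subgraphs and $\beta^*,\beta_1^*,\beta_2^*$ are the homomorphisms induced by the inclusions $L\subseteq G$, $L\subseteq K$, $K\subseteq G$ respectively, then $\beta^*=\beta_1^*\circ\beta_2^*:H^*(G)\to H^*(L)$.
   Context: Graphs are finite, loops and multiple edges allowed; a subgraph $K\subseteq G$ has $V(K)\subseteq V(G)$, $E(K)\subseteq E(G)$, and edges of $K$ are ordered by the restriction of the ordering of $E(G)$. $A=\mathbb{Z}[x]/(x^2)$, $B=\mathbb{Z}[y]/(y^2)$, bigraded with $\deg x=(1,0)$, $\deg y=(0,1)$. For a graph $G$ with ordered edges $e_1,\dots,e_n$ and $s\subseteq E(G)$, $[G:s]$ is the spanning subgraph (vertex set $V(G)$, edge set $s$), with $b_0(s)$ components and first Betti number $b_1(s)$; $C^s(G)=A^{\otimes b_0(s)}\otimes B^{\otimes b_1(s)}$ (one $A$ factor per component), $C^i(G)=\bigoplus_{|s|=i}C^s(G)$; for $e_j\notin s$ the per-edge map $d_{s,j}:C^s(G)\to C^{s\cup\{e_j\}}(G)$ multiplies the $A$ factors of the two components joined by $e_j$ if they are distinct (identity elsewhere), and otherwise is the identity on $A$ factors and $b\mapsto b\otimes 1$ on $B^{\otimes b_1(s)}$; $d^i=\sum_{|s|=i}\sum_{e_j\notin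 s}(-1)^{|\{k<j:e_k\in s\}|}d_{s,j}$; $H^i$ is its cohomology. The map $\beta:C^i(G)\to C^i(K)$ is defined summand-wise: if $s\not\subseteq E(K)$, $\beta|_{C^s(G)}=0$; if $s\subseteq E(K)$, then $[G:s]$ is $[K:s]$ together with the $l=|V(G)\setminus V(K)|$ remaining vertices as isolated vertices, so $C^s(G)\cong C^s(K)\otimes A^{\otimes l}$; writing $A^{\otimes l}=A_0\oplus A_1$ where $A_0\cong\mathbb{Z}$ is spanned by $1\otimes\cdots\otimes1$ and $A_1$ is spanned by the other tensor products of basis elements $1,x$, set $\beta(g\otimes1\otimes\cdots\otimes1)=g$ and $\beta(g\otimes a)=0$ for $g\in C^s(K)$, $a\in A_1$. -}

module Defs where

open import Data.Nat as ℕ using (ℕ; zero; suc; _∸_)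
open import Data.Fin as Fin using (Fin; toℕ)
open import Data.Fin.Subset using (Subset; ⁅_⁆; _∪_; ∣_∣; ⊤)
open import Data.Bool as Bool using (Bool; true; false; _∧_; _∨_; not; if_then_else_)
open import Data.Vec as Vec using (Vec; []; _∷_; lookup; tabulate)
import Data.Vec.Properties as VecP
open import Data.List as List using (List; []; _∷_; _++_; [_]; allFin; concatMap; map; filterᵇ; foldr; length)
open import Data.Bool.ListAction using (any; all)
import Data.List.Properties as ListP
open import Data.Integer as ℤ using (ℤ; 0ℤ; 1ℤ; -_; _*_; _+_; _-_)
open import Data.Product using (_×_; _,_; Σ-syntax)
open import Data.Sum using (_⊎_)
open import Relation.Nullary.Decidable using (⌊_⌋)
open import Relation.Binary.PropositionalEquality using (_≡_)

-- Finite graphs: vertices Fin nv, edges Fin ne (ordered by their index),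
-- each edge has two endpoints (loops and multiple edges allowed).

record Graph : Set where
  field
    nv   : ℕ
    ne   : ℕ
    src  : Fin ne → Fin nv
    tgt  : Fin ne → Fin nv
open Graph public

-- A subgraph of G: a vertex set and an edge set, with the endpoints of the
-- chosen edges among the chosen vertices.  Its edges are ordered by the
-- restriction of the ordering of E(G).
record SubG (G : Graph) : Set where
  field
    VS     : Subset (nv G)
    ES     : Subset (ne G)
    closed : ∀ e → lookup ES e ≡ true →
             (lookup VS (src G e) ≡ true) × (lookup VS (tgt G e) ≡ true)
open SubG public

_≤G_ : {G : Graph} → SubG G → SubG G → Set
_≤G_ {G} L K =
  (∀ v → lookup (VS L) v ≡ true → lookup (VS K) v ≡ true) ×
  (∀ e → lookup (ES L) e ≡ true → lookup (ES K) e ≡ true)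

fullG : (G : Graph) → SubG G
fullG G = record { VS = ⊤ ; ES = ⊤ ; closed = λ e _ → lemma (src G e) , lemma (tgt G e) }
  where
  lemma : ∀ {n} (i : Fin n) → lookup ⊤ i ≡ true
  lemma i rewrite VecP.lookup-replicate i true = Relation.Binary.PropositionalEquality.refl

eqFin : ∀ {n} → Fin n → Fin n → Bool
eqFin i j = ⌊ i Fin.≟ j ⌋

ltFin : ∀ {n} → Fin n → Fin n → Bool
ltFin i j = toℕ i ℕ.<ᵇ toℕ j

countF : ∀ {n} → (Fin n → Bool) → ℕ
countF {n} p = length (filterᵇ p (allFin n))

countTrue : List Bool → ℕ
countTrue w = length (filterᵇ (λ b → b) w)

allVecs : (n : ℕ) → List (Vec Bool n)
allVecs zero    = [ [] ]
allVecs (suc n) = concatMap (λ v → (true ∷ v) ∷ (false ∷ v) ∷ []) (allVecs n)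

module _ (G : Graph) where

  step : Subset (ne G) → Subset (nv G) → Subset (nv G)
  step s R = tabulate λ v → lookup R v ∨
    any (λ e → lookup s e ∧
               ((lookup R (src G e) ∧ eqFin (tgt G e) v) ∨
                (lookup R (tgt G e) ∧ eqFin (src G e) v)))
        (allFin (ne G))

  iter : ℕ → Subset (ne G) → Subset (nv G) → Subset (nv G)
  iter zero    s R = R
  iter (suc k) s R = step s (iter k s R)

  comp : Subset (ne G) → Fin (nv G) → Subset (nv G)
  comp s v = iter (nv G) s ⁅ v ⁆

  isRep : Subset (ne G) → Fin (nv G) → Bool
  isRep s v = not (any (λ w → ltFin w v ∧ lookup (comp s v) w) (allFin (nv G)))

module _ {G : Graph} (H : SubG G) where

  b0 : Subset (ne G) → ℕ
  b0 s = countF (λ v → lookup (VS H) v ∧ isRep G s v)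

  b1 : Subset (ne G) → ℕ
  b1 s = (∣ s ∣ ℕ.+ b0 s) ∸ ∣ VS H ∣

  ncompIn : Subset (ne G) → Subset (nv G) → ℕ
  ncompIn s X = countF (λ v → lookup (VS H) v ∧ isRep G s v ∧ lookup X v)

-- A basis element of C^s(H) = A^{⊗ b₀(s)} ⊗ B^{⊗ b₁(s)} is a tensor product of
-- basis elements 1, x (one per component) and 1, y (one per B factor);
-- it is encoded by (s , X , w) where X ⊆ V(H) is the union of the components
-- carrying x, and w ∈ Bool^{b₁(s)} lists the B factors (true = y).

subsetᵇ : ∀ {n} → Subset n → Subset n → Bool
subsetᵇ {n} p q = all (λ i → not (lookup p i) ∨ lookup q i) (allFin n)

Idx : Graph → Set
Idx G = Subset (ne G) × Subset (nv G) × List Bool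

module _ {G : Graph} where

  validᵇ : SubG G → Idx G → Bool
  validᵇ H (s , X , w) =
    subsetᵇ s (ES H) ∧ subsetᵇ X (VS H) ∧
    all (λ e → not (lookup s e) ∨
               ((lookup X (src G e) ∧ lookup X (tgt G e)) ∨
                (not (lookup X (src G e)) ∧ not (lookup X (tgt G e)))))
        (allFin (ne G)) ∧
    ⌊ length w ℕ.≟ b1 H s ⌋

  basis : SubG G → List (Idx G)
  basis H = filterᵇ (validᵇ H)
    (concatMap (λ s → concatMap (λ X → map (λ w → s , X , Vec.toList w) (allVecs (b1 H s)))
                                (allVecs (nv G)))
               (allVecs (ne G)))

  eqIdx : Idx G → Idx G → Bool
  eqIdx (s , X , w) (s' , X' , w') =
    ⌊ VecP.≡-dec Bool._≟_ s s' ⌋ ∧ ⌊ VecP.≡-dec Bool._≟_ X X' ⌋ ∧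
    ⌊ ListP.≡-dec Bool._≟_ w w' ⌋

  -- tridegree (i , j , k) of a basis element: i = |s|, j = number of x's,
  -- k = number of y's
  deg : SubG G → Idx G → ℕ × ℕ × ℕ
  deg H (s , X , w) = ∣ s ∣ , ncompIn H s X , countTrue w

-- Elements of C(H) are represented by their coefficient functions on basis
-- elements (vanishing outside the basis of C(H), see InC).
Chain : Graph → Set
Chain G = Idx G → ℤ

module _ {G : Graph} where

  zeroC : Chain G
  zeroC _ = 0ℤ

  _≈_ : Chain G → Chain G → Set
  c ≈ c' = ∀ x → c x ≡ c' x

  _-C_ : Chain G → Chain G → Chain G
  (c -C c') x = c x - c' x

  InC : SubG G → Chain G → Set
  InC H c = ∀ x → c x ≡ 0ℤ ⊎ (validᵇ H x ≡ true)

  InCi : SubG G → ℕ → Chain G → Set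
  InCi H i c = ∀ x → c x ≡ 0ℤ ⊎ ((validᵇ H x ≡ true) × (∣ Data.Product.proj₁ x ∣ ≡ i))

  InCdeg : SubG G → ℕ → ℕ → ℕ → Chain G → Set
  InCdeg H i j k c = ∀ x → c x ≡ 0ℤ ⊎ ((validᵇ H x ≡ true) × (deg H x ≡ (i , j , k)))

  -- the linear map from C(H) that sends each basis element b to the formal
  -- sum  f b  (a list of (coefficient , basis element))
  linExt : SubG G → (Idx G → List (ℤ × Idx G)) → Chain G → Chain G
  linExt H f c y =
    foldr _+_ 0ℤ (map (λ b → c b * foldr _+_ 0ℤ
                        (map (λ (p : ℤ × Idx G) → if eqIdx {G = G} (Data.Product.proj₂ p) y then Data.Product.proj₁ p else 0ℤ) (f b)))
                      (basis H))

  sgn : ℕ → ℤ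
  sgn zero    = 1ℤ
  sgn (suc n) = - sgn n

  -- image of the basis element (s , X , w) of C^s(H) under d_{s,e},
  -- multiplied by the sign (-1)^{|{k < e : e_k ∈ s}|}
  dEdge : SubG G → Idx G → Fin (ne G) → List (ℤ × Idx G)
  dEdge H (s , X , w) e =
    let u  = src G e
        v  = tgt G e
        s' = s ∪ ⁅ e ⁆
        ε  = sgn (countF (λ k → ltFin k e ∧ lookup s k))
    in if lookup (comp G s u) v
       -- e joins a component to itself: identity on A's, b ↦ b ⊗ 1 on B's
       then (ε , (s' , X , w ++ [ false ])) ∷ []
       -- e joins two distinct components: multiply their A factors
       else (if lookup X u ∧ lookup X v
             then []
             else (if lookup X u ∨ lookup X v
                   then (ε , (s' , X ∪ (comp G s u ∪ comp G s v) , w)) ∷ []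
                   else (ε , (s' , X , w)) ∷ []))

  dBasis : SubG G → Idx G → List (ℤ × Idx G)
  dBasis H b@(s , X , w) =
    concatMap (λ e → if lookup (ES H) e ∧ not (lookup s e) then dEdge H b e else [])
              (allFin (ne G))

  d : SubG G → Chain G → Chain G
  d H = linExt H (dBasis H)

  -- On the basis element (s , X , w) of C^s(H):
  -- zero if s ⊄ E(K); otherwise C^s(H) ≅ C^s(K) ⊗ A^{⊗ l} (l vertices of H
  -- not in K, isolated in [H : s]); the element lies in C^s(K) ⊗ A₀ iff no
  -- vertex outside V(K) carries x, i.e. X ⊆ V(K), and then it maps to
  -- (s , X , w) ∈ C^s(K); otherwise it lies in C^s(K) ⊗ A₁ and maps to 0.
  βBasis : SubG G → Idx G → List (ℤ × Idx G)
  βBasis K b@(s , X , w) =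
    if subsetᵇ s (ES K) ∧ subsetᵇ X (VS K) then (1ℤ , b) ∷ [] else []

  β : (H K : SubG G) → Chain G → Chain G
  β H K = linExt H (βBasis K)

  Cocycle : SubG G → ℕ → Chain G → Set
  Cocycle H i z = InCi H i z × (d H z ≈ zeroC)

  Coboundary : SubG G → ℕ → Chain G → Set
  Coboundary H zero    z = z ≈ zeroC
  Coboundary H (suc i) z = Σ[ y ∈ Chain G ] (InCi H i y × (z ≈ d H y))

-- In the basis of C(G) indexed by (s , X , w), β keeps the basis elements that lie in C(K)
-- (s ⊆ E(K) and X ⊆ V(K)) and kills all others.  Every term of d adds one edge to s and can
-- only enlarge X, so d never carries a killed basis element to a kept one; on a kept one, the
-- terms of d for edges outside E(K) are killed while the remaining ones are exactly those of
-- d_K.  This needs the two bases to match: for s ⊆ E(K) the vertices outside V(K) are isolated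
-- in [G : s], so b₁(s) is the same in K and in G; and adding an edge raises b₁ by one (closing
-- a cycle) or leaves it unchanged (joining two components), so every term of d is again a
-- basis element.  Naturality holds because both composites keep the same basis elements.

module Submission where

open import Defs
open import Data.Nat as ℕ using (ℕ; zero; suc; _∸_; _≤_; _<_; z≤n; s≤s)
import Data.Nat.Properties as ℕₚ
open import Data.Fin as Fin using (Fin; toℕ)
import Data.Fin.Properties as Finₚ
open import Data.Fin.Subset using (Subset; ⁅_⁆; _∪_; ∣_∣; ⊤; ⊥)
import Data.Fin.Subset.Properties as Subsetₚ
open import Data.Bool as Bool using (Bool; true; false; _∧_; _∨_; not; if_then_else_)
open import Data.Bool.Properties using (T-≡; ∨-zeroʳ; ∨-identityʳ; ∧-zeroʳ; ∧-identityʳ; ∧-comm)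
open import Data.Bool.ListAction using (any; all)
open import Data.Vec using (Vec; []; _∷_; lookup; toList; fromList)
import Data.Vec.Properties as Vecₚ
open import Data.List using (List; []; _∷_; _++_; map; foldr; concatMap; filterᵇ; length; tabulate; allFin)
import Data.List.Properties as Listₚ
import Data.List.Relation.Unary.All.Properties as Allₚ
import Data.List.Relation.Unary.Any.Properties as Anyₚ
open import Data.Integer using (ℤ; 0ℤ; _+_; _*_; _-_)
import Data.Integer.Properties as ℤₚ
open import Data.Product using (Σ; _×_; _,_; Σ-syntax; ∃; proj₁; proj₂)
open import Data.Sum using (_⊎_; inj₁; inj₂; [_,_])
open import Data.Empty using (⊥-elim)
open import Function using (id; _∘_)
open import Function.Bundles using (Equivalence)
open import Relation.Nullary using (yes; no)
open import Relation.Nullary.Decidable using (⌊_⌋; T?; toWitness; fromWitness)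
open import Relation.Binary.PropositionalEquality hiding ([_])
open import Relation.Binary.Definitions using (tri<; tri≈; tri>)

true≢false : true ≢ false
true≢false ()

≡true-ext : ∀ {a b : Bool} → (a ≡ true → b ≡ true) → (b ≡ true → a ≡ true) → a ≡ b
≡true-ext {true}  {true}  _ _ = refl
≡true-ext {false} {false} _ _ = refl
≡true-ext {true}  {false} f _ = sym (f refl)
≡true-ext {false} {true}  _ g = g refl

∧-true⁻ : ∀ {a b} → a ∧ b ≡ true → (a ≡ true) × (b ≡ true)
∧-true⁻ {true} {true} _ = refl , refl

∨-true⁻ : ∀ {a b} → a ∨ b ≡ true → (a ≡ true) ⊎ (b ≡ true)
∨-true⁻ {true}  _ = inj₁ refl
∨-true⁻ {false} h = inj₂ h

if-true : ∀ {b : Bool} (x : ℤ) → b ≡ true → (if b then x else 0ℤ) ≡ x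
if-true x refl = refl

if-false : ∀ {b : Bool} (x : ℤ) → b ≡ false → (if b then x else 0ℤ) ≡ 0ℤ
if-false x refl = refl

if-0 : ∀ b {x : ℤ} → x ≡ 0ℤ → (if b then x else 0ℤ) ≡ 0ℤ
if-0 true  h = h
if-0 false _ = refl

*-if : ∀ b (a x : ℤ) → (if b then a * x else 0ℤ) ≡ a * (if b then x else 0ℤ)
*-if true  a x = refl
*-if false a x = sym (ℤₚ.*-zeroʳ a)

all-allFin⁻ : ∀ {n} (p : Fin n → Bool) → all p (allFin n) ≡ true → ∀ i → p i ≡ true
all-allFin⁻ p h i =
  Equivalence.to T-≡ (Allₚ.tabulate⁻ (Allₚ.all⁺ p _ (Equivalence.from T-≡ h)) i)

all-allFin⁺ : ∀ {n} (p : Fin n → Bool) → (∀ i → p i ≡ true) → all p (allFin n) ≡ true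
all-allFin⁺ p h =
  Equivalence.to T-≡ (Allₚ.all⁻ p (Allₚ.tabulate⁺ (Equivalence.from T-≡ ∘ h)))

any-allFin⁻ : ∀ {n} (p : Fin n → Bool) → any p (allFin n) ≡ true → ∃ λ i → p i ≡ true
any-allFin⁻ p h with Anyₚ.tabulate⁻ (Anyₚ.any⁻ p _ (Equivalence.from T-≡ h))
... | i , pi = i , Equivalence.to T-≡ pi

any-allFin⁺ : ∀ {n} (p : Fin n → Bool) i → p i ≡ true → any p (allFin n) ≡ true
any-allFin⁺ p i h =
  Equivalence.to T-≡ (Anyₚ.any⁺ p (Anyₚ.tabulate⁺ i (Equivalence.from T-≡ h)))

eqFin⇒≡ : ∀ {n} (i j : Fin n) → eqFin i j ≡ true → i ≡ j
eqFin⇒≡ i j h with i Finₚ.≟ j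
... | yes i≡j = i≡j

eqFin-refl : ∀ {n} (i : Fin n) → eqFin i i ≡ true
eqFin-refl i with i Finₚ.≟ i
... | yes _  = refl
... | no i≢i = ⊥-elim (i≢i refl)

ltFin⇒< : ∀ {n} (i j : Fin n) → ltFin i j ≡ true → toℕ i < toℕ j
ltFin⇒< i j h = ℕₚ.<ᵇ⇒< (toℕ i) (toℕ j) (Equivalence.from T-≡ h)

<⇒ltFin : ∀ {n} (i j : Fin n) → toℕ i < toℕ j → ltFin i j ≡ true
<⇒ltFin i j h = Equivalence.to T-≡ (ℕₚ.<⇒<ᵇ h)

≟-true⁻ : ∀ {m n : ℕ} → ⌊ m ℕ.≟ n ⌋ ≡ true → m ≡ n
≟-true⁻ = toWitness ∘ Equivalence.from T-≡

≟-true⁺ : ∀ {m n : ℕ} → m ≡ n → ⌊ m ℕ.≟ n ⌋ ≡ true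
≟-true⁺ = Equivalence.to T-≡ ∘ fromWitness

least : ∀ {n} (P : Fin n → Bool) a → P a ≡ true →
        Σ[ m ∈ Fin n ] (P m ≡ true) × (∀ x → P x ≡ true → toℕ m ≤ toℕ x)
least {suc n} P a pa with P Fin.zero in p0
... | true = Fin.zero , p0 , λ _ _ → z≤n
least {suc n} P Fin.zero    pa | false = ⊥-elim (true≢false (trans (sym pa) p0))
least {suc n} P (Fin.suc a) pa | false with least (P ∘ Fin.suc) a pa
... | m , pm , m-least = Fin.suc m , pm , bound
  where
  bound : ∀ x → P x ≡ true → toℕ (Fin.suc m) ≤ toℕ x
  bound Fin.zero    px = ⊥-elim (true≢false (trans (sym px) p0))
  bound (Fin.suc x) px = s≤s (m-least x px)

infix 4 _⊑_
_⊑_ : ∀ {n} → (Fin n → Bool) → (Fin n → Bool) → Set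
P ⊑ Q = ∀ i → P i ≡ true → Q i ≡ true

lookup-∪ : ∀ {n} (p q : Subset n) i → lookup (p ∪ q) i ≡ (lookup p i ∨ lookup q i)
lookup-∪ p q i = Vecₚ.lookup-zipWith _∨_ i p q

lookup-⊤ : ∀ {n} (i : Fin n) → lookup ⊤ i ≡ true
lookup-⊤ i = Vecₚ.lookup-replicate i true

lookup-⊥ : ∀ {n} (i : Fin n) → lookup ⊥ i ≡ false
lookup-⊥ i = Vecₚ.lookup-replicate i false

lookup-⁅⁆ : ∀ {n} (i : Fin n) → lookup ⁅ i ⁆ i ≡ true
lookup-⁅⁆ i = Vecₚ.[]=⇒lookup (Subsetₚ.x∈⁅x⁆ i)

lookup-⁅⁆⁻ : ∀ {n} (e i : Fin n) → lookup ⁅ e ⁆ i ≡ true → i ≡ e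
lookup-⁅⁆⁻ e i h = Subsetₚ.x∈⁅y⁆⇒x≡y e (Vecₚ.lookup⇒[]= i _ h)

⊑-∪⁅⁆ : ∀ {n} (s : Subset n) e → lookup s ⊑ lookup (s ∪ ⁅ e ⁆)
⊑-∪⁅⁆ s e i h rewrite lookup-∪ s ⁅ e ⁆ i | h = refl

∈-∪⁅⁆ : ∀ {n} (s : Subset n) e → lookup (s ∪ ⁅ e ⁆) e ≡ true
∈-∪⁅⁆ s e rewrite lookup-∪ s ⁅ e ⁆ e | lookup-⁅⁆ e = ∨-zeroʳ _

∪⁅⁆-⊑ : ∀ {n} (s t : Subset n) e → lookup s ⊑ lookup t → lookup t e ≡ true →
        lookup (s ∪ ⁅ e ⁆) ⊑ lookup t
∪⁅⁆-⊑ s t e s⊑t te i h with ∨-true⁻ (trans (sym (lookup-∪ s ⁅ e ⁆ i)) h)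
... | inj₁ si = s⊑t i si
... | inj₂ ei rewrite lookup-⁅⁆⁻ e i ei = te

subsetᵇ⁻ : ∀ {n} (p q : Subset n) → subsetᵇ p q ≡ true → lookup p ⊑ lookup q
subsetᵇ⁻ p q h i pi with all-allFin⁻ (λ i → not (lookup p i) ∨ lookup q i) h i
... | r rewrite pi = r

subsetᵇ⁺ : ∀ {n} (p q : Subset n) → lookup p ⊑ lookup q → subsetᵇ p q ≡ true
subsetᵇ⁺ p q p⊑q = all-allFin⁺ (λ i → not (lookup p i) ∨ lookup q i) pointwise
  where
  pointwise : ∀ i → not (lookup p i) ∨ lookup q i ≡ true
  pointwise i with lookup p i in pi
  ... | false = refl
  ... | true  = p⊑q i pi

subsetᵇ-⊤ : ∀ {n} (p : Subset n) → subsetᵇ p ⊤ ≡ true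
subsetᵇ-⊤ p = subsetᵇ⁺ p ⊤ (λ i _ → lookup-⊤ i)

∣∣-mono : ∀ {n} (p q : Subset n) → lookup p ⊑ lookup q → ∣ p ∣ ≤ ∣ q ∣
∣∣-mono p q p⊑q =
  Subsetₚ.p⊆q⇒∣p∣≤∣q∣ {p = p} (λ {i} i∈p → Vecₚ.lookup⇒[]= i q (p⊑q i (Vecₚ.[]=⇒lookup i∈p)))

∣∣-strict : ∀ {n} (p q : Subset n) → lookup p ⊑ lookup q → p ≢ q → ∣ p ∣ < ∣ q ∣
∣∣-strict []          []          _   p≢q = ⊥-elim (p≢q refl)
∣∣-strict (true ∷ p)  (true ∷ q)  p⊑q p≢q =
  s≤s (∣∣-strict p q (p⊑q ∘ Fin.suc) (p≢q ∘ cong (true ∷_)))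
∣∣-strict (false ∷ p) (true ∷ q)  p⊑q _   = s≤s (∣∣-mono p q (p⊑q ∘ Fin.suc))
∣∣-strict (false ∷ p) (false ∷ q) p⊑q p≢q =
  ∣∣-strict p q (p⊑q ∘ Fin.suc) (p≢q ∘ cong (false ∷_))
∣∣-strict (true ∷ p)  (false ∷ q) p⊑q _   = ⊥-elim (true≢false (sym (p⊑q Fin.zero refl)))

∣∪⁅⁆∣ : ∀ {n} (s : Subset n) e → lookup s e ≡ false → ∣ s ∪ ⁅ e ⁆ ∣ ≡ suc ∣ s ∣
∣∪⁅⁆∣ (false ∷ s) Fin.zero    _ = cong (suc ∘ ∣_∣) (Subsetₚ.∪-identityʳ s)
∣∪⁅⁆∣ (true  ∷ s) (Fin.suc e) h = cong suc (∣∪⁅⁆∣ s e h)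
∣∪⁅⁆∣ (false ∷ s) (Fin.suc e) h = ∣∪⁅⁆∣ s e h

delete : ∀ {n} → Subset n → Fin n → Subset n
delete (_ ∷ s) Fin.zero    = false ∷ s
delete (x ∷ s) (Fin.suc i) = x ∷ delete s i

lookup-delete : ∀ {n} (s : Subset n) e → lookup (delete s e) e ≡ false
lookup-delete (_ ∷ s) Fin.zero    = refl
lookup-delete (_ ∷ s) (Fin.suc e) = lookup-delete s e

delete-∪⁅⁆ : ∀ {n} (s : Subset n) e → lookup s e ≡ true → delete s e ∪ ⁅ e ⁆ ≡ s
delete-∪⁅⁆ (true ∷ s) Fin.zero    _ = cong (true ∷_) (Subsetₚ.∪-identityʳ s)
delete-∪⁅⁆ (x ∷ s)    (Fin.suc e) h = cong₂ _∷_ (∨-identityʳ x) (delete-∪⁅⁆ s e h)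

∣s∣≡suc⇒∈ : ∀ {n} (s : Subset n) {k} → ∣ s ∣ ≡ suc k → ∃ λ e → lookup s e ≡ true
∣s∣≡suc⇒∈ (true  ∷ s) _ = Fin.zero , refl
∣s∣≡suc⇒∈ (false ∷ s) h with ∣s∣≡suc⇒∈ s h
... | e , se = Fin.suc e , se

∣s∣≡0⇒s≡⊥ : ∀ {n} (s : Subset n) → ∣ s ∣ ≡ 0 → s ≡ ⊥
∣s∣≡0⇒s≡⊥ []          _ = refl
∣s∣≡0⇒s≡⊥ (false ∷ s) h = cong (false ∷_) (∣s∣≡0⇒s≡⊥ s h)

count : ∀ {A : Set} → (A → Bool) → List A → ℕ
count p L = length (filterᵇ p L)

count-cong : ∀ {A : Set} (L : List A) {p q : A → Bool} → (∀ a → p a ≡ q a) → count p L ≡ count q L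
count-cong []      _   = refl
count-cong (x ∷ L) {p} {q} p≗q with p x | q x | p≗q x
... | true  | true  | refl = cong suc (count-cong L p≗q)
... | false | false | refl = count-cong L p≗q

count-split : ∀ {A : Set} (L : List A) (p q : A → Bool) →
              count p L ≡ count (λ a → p a ∧ q a) L ℕ.+ count (λ a → p a ∧ not (q a)) L
count-split []      p q = refl
count-split (x ∷ L) p q with p x | q x
... | true  | true  = cong suc (count-split L p q)
... | true  | false = trans (cong suc (count-split L p q)) (sym (ℕₚ.+-suc _ _))
... | false | true  = count-split L p q
... | false | false = count-split L p q

count-tabulate : ∀ {A : Set} {n} (p : A → Bool) (f : Fin n → A) →
                 count p (tabulate f) ≡ countF (p ∘ f)
count-tabulate {n = zero}  p f = refl
count-tabulate {n = suc n} p f with p (f Fin.zero)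
... | true  = cong suc (trans (count-tabulate p (f ∘ Fin.suc)) (sym (count-tabulate (p ∘ f) Fin.suc)))
... | false = trans (count-tabulate p (f ∘ Fin.suc)) (sym (count-tabulate (p ∘ f) Fin.suc))

countF-all : ∀ {n} (p : Fin n → Bool) → (∀ i → p i ≡ true) → countF p ≡ n
countF-all {n} p h =
  trans (cong length (Listₚ.filter-all (T? ∘ p) (Allₚ.tabulate⁺ (Equivalence.from T-≡ ∘ h))))
        (Listₚ.length-tabulate id)

count-tabulate-suc : ∀ {A : Set} {n} (f : Fin n → A) (p q : A → Bool) i →
  p (f i) ≡ true → q (f i) ≡ false → (∀ j → j ≢ i → p (f j) ≡ q (f j)) →
  count p (tabulate f) ≡ suc (count q (tabulate f))
count-tabulate-suc {n = suc n} f p q Fin.zero pi qi p≗q rewrite pi | qi =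
  cong suc (trans (count-tabulate p (f ∘ Fin.suc))
          (trans (count-cong (allFin n) (λ j → p≗q (Fin.suc j) λ ()))
                 (sym (count-tabulate q (f ∘ Fin.suc)))))
count-tabulate-suc {n = suc n} f p q (Fin.suc i) pi qi p≗q
  with p (f Fin.zero) | q (f Fin.zero) | p≗q Fin.zero (λ ())
... | true  | true  | refl =
  cong suc (count-tabulate-suc (f ∘ Fin.suc) p q i pi qi (λ j j≢i → p≗q (Fin.suc j) (j≢i ∘ Finₚ.suc-injective)))
... | false | false | refl =
  count-tabulate-suc (f ∘ Fin.suc) p q i pi qi (λ j j≢i → p≗q (Fin.suc j) (j≢i ∘ Finₚ.suc-injective))

∣p∣+∣∁p∣ : ∀ {n} (p : Subset n) → ∣ p ∣ ℕ.+ countF (not ∘ lookup p) ≡ n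
∣p∣+∣∁p∣ []          = refl
∣p∣+∣∁p∣ (true ∷ p)  =
  cong suc (trans (cong (∣ p ∣ ℕ.+_) (count-tabulate (not ∘ lookup (true ∷ p)) Fin.suc)) (∣p∣+∣∁p∣ p))
∣p∣+∣∁p∣ (false ∷ p) = trans (ℕₚ.+-suc ∣ p ∣ _)
  (cong suc (trans (cong (∣ p ∣ ℕ.+_) (count-tabulate (not ∘ lookup (false ∷ p)) Fin.suc)) (∣p∣+∣∁p∣ p)))

∑ : ∀ {A : Set} → List A → (A → ℤ) → ℤ
∑ L h = foldr _+_ 0ℤ (map h L)

∑-cong : ∀ {A : Set} (L : List A) {h h′ : A → ℤ} → (∀ a → h a ≡ h′ a) → ∑ L h ≡ ∑ L h′
∑-cong []      _  = refl
∑-cong (x ∷ L) eq = cong₂ _+_ (eq x) (∑-cong L eq)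

∑-zero : ∀ {A : Set} (L : List A) {h : A → ℤ} → (∀ a → h a ≡ 0ℤ) → ∑ L h ≡ 0ℤ
∑-zero []      _  = refl
∑-zero (x ∷ L) eq rewrite eq x | ∑-zero L eq = refl

∑-++ : ∀ {A : Set} (L M : List A) (h : A → ℤ) → ∑ (L ++ M) h ≡ ∑ L h + ∑ M h
∑-++ []      M h = sym (ℤₚ.+-identityˡ _)
∑-++ (x ∷ L) M h rewrite ∑-++ L M h = sym (ℤₚ.+-assoc (h x) _ _)

∑-concatMap : ∀ {A B : Set} (f : A → List B) (L : List A) (h : B → ℤ) →
              ∑ (concatMap f L) h ≡ ∑ L (λ a → ∑ (f a) h)
∑-concatMap f []      h = refl
∑-concatMap f (x ∷ L) h = trans (∑-++ (f x) (concatMap f L) h) (cong (∑ (f x) h +_) (∑-concatMap f L h))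

∑-map : ∀ {A B : Set} (f : A → B) (L : List A) (h : B → ℤ) → ∑ (map f L) h ≡ ∑ L (h ∘ f)
∑-map f []      h = refl
∑-map f (x ∷ L) h = cong (h (f x) +_) (∑-map f L h)

∑-filterᵇ : ∀ {A : Set} (p : A → Bool) (L : List A) (h : A → ℤ) →
            ∑ (filterᵇ p L) h ≡ ∑ L (λ a → if p a then h a else 0ℤ)
∑-filterᵇ p []      h = refl
∑-filterᵇ p (x ∷ L) h with p x
... | true  = cong (h x +_) (∑-filterᵇ p L h)
... | false = trans (∑-filterᵇ p L h) (sym (ℤₚ.+-identityˡ _))

∑-if : ∀ {A : Set} (b : Bool) (L : List A) (h : A → ℤ) →
       ∑ (if b then L else []) h ≡ (if b then ∑ L h else 0ℤ)
∑-if true  L h = refl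
∑-if false L h = refl

if-∑ : ∀ {A : Set} (b : Bool) (L : List A) (h : A → ℤ) →
       (if b then ∑ L h else 0ℤ) ≡ ∑ L (λ a → if b then h a else 0ℤ)
if-∑ true  L h = refl
if-∑ false L h = sym (∑-zero L (λ _ → refl))

∑-allVecs-single : ∀ n (h : Vec Bool n → ℤ) v → (∀ u → u ≢ v → h u ≡ 0ℤ) → ∑ (allVecs n) h ≡ h v
∑-allVecs-single zero    h []      _   = ℤₚ.+-identityʳ _
∑-allVecs-single (suc n) h (b ∷ v) off =
  trans (∑-concatMap (λ u → (true ∷ u) ∷ (false ∷ u) ∷ []) (allVecs n) h)
        (trans (∑-allVecs-single n both v off′) (both-at b off))
  where
  both : Vec Bool n → ℤ
  both u = h (true ∷ u) + (h (false ∷ u) + 0ℤ)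
  off′ : ∀ u → u ≢ v → both u ≡ 0ℤ
  off′ u u≢v rewrite off (true ∷ u) (u≢v ∘ Vecₚ.∷-injectiveʳ)
                   | off (false ∷ u) (u≢v ∘ Vecₚ.∷-injectiveʳ) = refl
  both-at : ∀ b → (∀ u → u ≢ b ∷ v → h u ≡ 0ℤ) → both v ≡ h (b ∷ v)
  both-at true  off rewrite off (false ∷ v) (λ ()) = ℤₚ.+-identityʳ _
  both-at false off rewrite off (true ∷ v) (λ ()) = trans (ℤₚ.+-identityˡ _) (ℤₚ.+-identityʳ _)

∑-allVecs-toList-single : ∀ n (T : List Bool → ℤ) w → (∀ l → l ≢ w → T l ≡ 0ℤ) →
  ∑ (allVecs n) (T ∘ toList) ≡ (if ⌊ length w ℕ.≟ n ⌋ then T w else 0ℤ)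
∑-allVecs-toList-single n T w off with length w ℕ.≟ n
... | yes refl =
  trans (∑-allVecs-single (length w) (T ∘ toList) (fromList w) (λ v v≢ → off (toList v) (v≢ ∘ toList≡)))
        (cong T (Vecₚ.toList∘fromList w))
  where
  toList≡ : ∀ {v} → toList v ≡ w → v ≡ fromList w
  toList≡ {v} eq = trans (sym (Vecₚ.cast-is-id refl v))
    (Vecₚ.toList-injective refl v (fromList w) (trans eq (sym (Vecₚ.toList∘fromList w))))
... | no ∣w∣≢n =
  ∑-zero (allVecs n) (λ v → off (toList v) (λ eq → ∣w∣≢n (trans (sym (cong length eq)) (Vecₚ.length-toList v))))

-- Components of a spanning subgraph

module _ (G : Graph) where

  Closed : Subset (ne G) → (Fin (nv G) → Bool) → Set
  Closed s Q = ∀ e → lookup s e ≡ true → Q (src G e) ≡ Q (tgt G e)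

  Closed-resp : ∀ s {Q Q′ : Fin (nv G) → Bool} → (∀ x → Q x ≡ Q′ x) → Closed s Q → Closed s Q′
  Closed-resp s Q≗Q′ c e se = trans (sym (Q≗Q′ _)) (trans (c e se) (Q≗Q′ _))

  Closed-∪⁅⁆ : ∀ s e Q → Closed s Q → Q (src G e) ≡ Q (tgt G e) → Closed (s ∪ ⁅ e ⁆) Q
  Closed-∪⁅⁆ s e Q c qe k sk with ∨-true⁻ (trans (sym (lookup-∪ s ⁅ e ⁆ k)) sk)
  ... | inj₁ k∈s = c k k∈s
  ... | inj₂ k∈e rewrite lookup-⁅⁆⁻ e k k∈e = qe

  joins : Subset (ne G) → Subset (nv G) → Fin (nv G) → Fin (ne G) → Bool
  joins s R v e = lookup s e ∧ ((lookup R (src G e) ∧ eqFin (tgt G e) v) ∨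
                                (lookup R (tgt G e) ∧ eqFin (src G e) v))

  lookup-step : ∀ s R v → lookup (step G s R) v ≡ (lookup R v ∨ any (joins s R v) (allFin (ne G)))
  lookup-step s R v = Vecₚ.lookup∘tabulate _ v

  ⊑-step : ∀ s R → lookup R ⊑ lookup (step G s R)
  ⊑-step s R v h rewrite lookup-step s R v | h = refl

  step⁻ : ∀ s R v → lookup (step G s R) v ≡ true →
    (lookup R v ≡ true) ⊎
    (Σ[ e ∈ Fin (ne G) ] (lookup s e ≡ true) ×
      (((lookup R (src G e) ≡ true) × (tgt G e ≡ v)) ⊎ ((lookup R (tgt G e) ≡ true) × (src G e ≡ v))))
  step⁻ s R v h rewrite lookup-step s R v with ∨-true⁻ h
  ... | inj₁ v∈R = inj₁ v∈R
  ... | inj₂ joined with any-allFin⁻ (joins s R v) joined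
  ... | e , je with ∧-true⁻ je
  ... | se , ends with ∨-true⁻ ends
  ... | inj₁ fwd = let (r , eq) = ∧-true⁻ fwd in inj₂ (e , se , inj₁ (r , eqFin⇒≡ _ _ eq))
  ... | inj₂ bwd = let (r , eq) = ∧-true⁻ bwd in inj₂ (e , se , inj₂ (r , eqFin⇒≡ _ _ eq))

  step-tgt : ∀ s R e → lookup s e ≡ true → lookup R (src G e) ≡ true → lookup (step G s R) (tgt G e) ≡ true
  step-tgt s R e se h = trans (lookup-step s R (tgt G e))
    (trans (cong (lookup R (tgt G e) ∨_) (any-allFin⁺ _ e joined)) (∨-zeroʳ _))
    where
    joined : joins s R (tgt G e) e ≡ true
    joined rewrite se | h | eqFin-refl (tgt G e) = refl

  step-src : ∀ s R e → lookup s e ≡ true → lookup R (tgt G e) ≡ true → lookup (step G s R) (src G e) ≡ true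
  step-src s R e se h = trans (lookup-step s R (src G e))
    (trans (cong (lookup R (src G e) ∨_) (any-allFin⁺ _ e joined)) (∨-zeroʳ _))
    where
    joined : joins s R (src G e) e ≡ true
    joined rewrite se | h | eqFin-refl (src G e) = ∨-zeroʳ _

  step-⊑ : ∀ s R Q → Closed s Q → lookup R ⊑ Q → lookup (step G s R) ⊑ Q
  step-⊑ s R Q c R⊑Q v h with step⁻ s R v h
  ... | inj₁ v∈R = R⊑Q v v∈R
  ... | inj₂ (e , se , inj₁ (r , refl)) = trans (sym (c e se)) (R⊑Q _ r)
  ... | inj₂ (e , se , inj₂ (r , refl)) = trans (c e se) (R⊑Q _ r)

  iter-⊑ : ∀ k s R Q → Closed s Q → lookup R ⊑ Q → lookup (iter G k s R) ⊑ Q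
  iter-⊑ zero    s R Q c R⊑Q = R⊑Q
  iter-⊑ (suc k) s R Q c R⊑Q = step-⊑ s (iter G k s R) Q c (iter-⊑ k s R Q c R⊑Q)

  ⊑-iter : ∀ k s R → lookup R ⊑ lookup (iter G k s R)
  ⊑-iter zero    s R v h = h
  ⊑-iter (suc k) s R v h = ⊑-step s (iter G k s R) v (⊑-iter k s R v h)

  comp-least : ∀ s u Q → Closed s Q → Q u ≡ true → lookup (comp G s u) ⊑ Q
  comp-least s u Q c qu =
    iter-⊑ (nv G) s ⁅ u ⁆ Q c (λ x h → subst (λ z → Q z ≡ true) (sym (lookup-⁅⁆⁻ u x h)) qu)

  comp-refl : ∀ s u → lookup (comp G s u) u ≡ true
  comp-refl s u = ⊑-iter (nv G) s ⁅ u ⁆ u (lookup-⁅⁆ u)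

  step-fixed⇒Closed : ∀ s R → step G s R ≡ R → Closed s (lookup R)
  step-fixed⇒Closed s R fixed e se = ≡true-ext
    (λ h → subst (λ S → lookup S (tgt G e) ≡ true) fixed (step-tgt s R e se h))
    (λ h → subst (λ S → lookup S (src G e) ≡ true) fixed (step-src s R e se h))

  -- Each step either is stationary or adds a vertex, so nv G steps reach a fixed point.
  iter-grows : ∀ s u k → (iter G (suc k) s ⁅ u ⁆ ≡ iter G k s ⁅ u ⁆) ⊎ (suc k ≤ ∣ iter G k s ⁅ u ⁆ ∣)
  iter-grows s u zero = inj₂ (ℕₚ.≤-reflexive (sym (Subsetₚ.∣⁅x⁆∣≡1 u)))
  iter-grows s u (suc k) with iter-grows s u k
  ... | inj₁ fixed = inj₁ (cong (step G s) fixed)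
  ... | inj₂ big with Vecₚ.≡-dec Bool._≟_ (iter G k s ⁅ u ⁆) (iter G (suc k) s ⁅ u ⁆)
  ... | yes same = inj₁ (cong (step G s) (sym same))
  ... | no grew  = inj₂ (ℕₚ.≤-trans (s≤s big)
                     (∣∣-strict (iter G k s ⁅ u ⁆) _ (⊑-step s (iter G k s ⁅ u ⁆)) grew))

  comp-closed : ∀ s u → Closed s (lookup (comp G s u))
  comp-closed s u with iter-grows s u (nv G)
  ... | inj₁ fixed = step-fixed⇒Closed s _ fixed
  ... | inj₂ big   = ⊥-elim (ℕₚ.<-irrefl refl (ℕₚ.≤-trans big (Subsetₚ.∣p∣≤n (comp G s u))))

  comp-trans : ∀ s a b x → lookup (comp G s a) b ≡ true → lookup (comp G s b) x ≡ true →
               lookup (comp G s a) x ≡ true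
  comp-trans s a b x ab bx = comp-least s b (lookup (comp G s a)) (comp-closed s a) ab x bx

  comp-src : ∀ s e → lookup s e ≡ true → lookup (comp G s (tgt G e)) (src G e) ≡ true
  comp-src s e se = trans (comp-closed s (tgt G e) e se) (comp-refl s (tgt G e))

  comp-tgt : ∀ s e → lookup s e ≡ true → lookup (comp G s (src G e)) (tgt G e) ≡ true
  comp-tgt s e se = trans (sym (comp-closed s (src G e) e se)) (comp-refl s (src G e))

  iter-sym : ∀ s b k a → lookup (iter G k s ⁅ b ⁆) a ≡ true → lookup (comp G s a) b ≡ true
  iter-sym s b zero a h rewrite lookup-⁅⁆⁻ b a h = comp-refl s b
  iter-sym s b (suc k) a h with step⁻ s (iter G k s ⁅ b ⁆) a h
  ... | inj₁ r = iter-sym s b k a r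
  ... | inj₂ (e , se , inj₁ (r , refl)) = comp-trans s _ (src G e) b (comp-src s e se) (iter-sym s b k _ r)
  ... | inj₂ (e , se , inj₂ (r , refl)) = comp-trans s _ (tgt G e) b (comp-tgt s e se) (iter-sym s b k _ r)

  comp-sym : ∀ s a b → lookup (comp G s a) b ≡ true → lookup (comp G s b) a ≡ true
  comp-sym s a b = iter-sym s a (nv G) b

  comp-mono : ∀ s s′ u → lookup s ⊑ lookup s′ → lookup (comp G s u) ⊑ lookup (comp G s′ u)
  comp-mono s s′ u s⊑s′ = comp-least s u _ (λ e se → comp-closed s′ u e (s⊑s′ e se)) (comp-refl s′ u)

  comp-≡ : ∀ s a b → lookup (comp G s a) b ≡ true → ∀ x → lookup (comp G s a) x ≡ lookup (comp G s b) x
  comp-≡ s a b ab x = ≡true-ext (comp-trans s b a x (comp-sym s a b ab)) (comp-trans s a b x ab)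

  Closed-const : ∀ s Q u v → Closed s Q → lookup (comp G s u) v ≡ true → Q u ≡ Q v
  Closed-const s Q u v c h = ≡true-ext (λ qu → comp-least s u Q c qu v h)
                                       (λ qv → comp-least s v Q c qv u (comp-sym s u v h))

  ncomp : Subset (ne G) → ℕ
  ncomp s = countF (isRep G s)

  isRep-false⁻ : ∀ s v → isRep G s v ≡ false → ∃ λ w → (toℕ w < toℕ v) × (lookup (comp G s v) w ≡ true)
  isRep-false⁻ s v h with any (λ w → ltFin w v ∧ lookup (comp G s v) w) (allFin (nv G)) in found
  ... | true with any-allFin⁻ _ found
  ... | w , w<v∧vw = let (w<v , vw) = ∧-true⁻ w<v∧vw in w , ltFin⇒< w v w<v , vw

  isRep-true⁻ : ∀ s v → isRep G s v ≡ true → ∀ w → lookup (comp G s v) w ≡ true → toℕ v ≤ toℕ w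
  isRep-true⁻ s v h w vw with any (λ w → ltFin w v ∧ lookup (comp G s v) w) (allFin (nv G)) in none
  ... | false with toℕ v ℕₚ.≤? toℕ w
  ...   | yes v≤w = v≤w
  ...   | no  v≰w = ⊥-elim (true≢false (trans (sym (any-allFin⁺ _ w
                      (cong₂ _∧_ (<⇒ltFin w v (ℕₚ.≰⇒> v≰w)) vw))) none))

  isRep-true⁺ : ∀ s v → (∀ w → lookup (comp G s v) w ≡ true → toℕ v ≤ toℕ w) → isRep G s v ≡ true
  isRep-true⁺ s v minimal with isRep G s v in r
  ... | true  = refl
  ... | false with isRep-false⁻ s v r
  ...   | w , w<v , vw = ⊥-elim (ℕₚ.<⇒≱ w<v (minimal w vw))

  isRep-false⁺ : ∀ s v w → toℕ w < toℕ v → lookup (comp G s v) w ≡ true → isRep G s v ≡ false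
  isRep-false⁺ s v w w<v vw with isRep G s v in r
  ... | false = refl
  ... | true  = ⊥-elim (ℕₚ.<⇒≱ w<v (isRep-true⁻ s v r w vw))

  isRep-cong : ∀ s s′ v → (∀ x → lookup (comp G s v) x ≡ lookup (comp G s′ v) x) →
               isRep G s v ≡ isRep G s′ v
  isRep-cong s s′ v same = ≡true-ext
    (λ h → isRep-true⁺ s′ v (λ w cw → isRep-true⁻ s v h w (trans (same w) cw)))
    (λ h → isRep-true⁺ s v (λ w cw → isRep-true⁻ s′ v h w (trans (sym (same w)) cw)))

  Representative : Subset (ne G) → Fin (nv G) → Fin (nv G) → Set
  Representative s a r = (lookup (comp G s a) r ≡ true) × (isRep G s r ≡ true) ×
                         (∀ x → lookup (comp G s a) x ≡ true → toℕ r ≤ toℕ x)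

  representative : ∀ s a → Σ[ r ∈ Fin (nv G) ] Representative s a r
  representative s a with least (lookup (comp G s a)) a (comp-refl s a)
  ... | r , ar , r-least =
    r , ar , isRep-true⁺ s r (λ w rw → r-least w (trans (comp-≡ s a r ar w) rw)) , r-least

  isolated⇒isRep : ∀ s v → (∀ e → lookup s e ≡ true → (src G e ≢ v) × (tgt G e ≢ v)) → isRep G s v ≡ true
  isolated⇒isRep s v isolated = isRep-true⁺ s v (λ x vx →
    ℕₚ.≤-reflexive (cong toℕ (sym (eqFin⇒≡ x v (comp-least s v (λ x → eqFin x v) unmoved (eqFin-refl v) x vx)))))
    where
    ≢⇒eqFin : ∀ x → x ≢ v → eqFin x v ≡ false
    ≢⇒eqFin x x≢v with x Finₚ.≟ v
    ... | yes x≡v = ⊥-elim (x≢v x≡v)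
    ... | no _    = refl
    unmoved : Closed s (λ x → eqFin x v)
    unmoved e se = trans (≢⇒eqFin _ (proj₁ (isolated e se))) (sym (≢⇒eqFin _ (proj₂ (isolated e se))))

  -- s′ ⊇ s is s with the vertices a and b glued together.
  module Merge (s s′ : Subset (ne G)) (a b : Fin (nv G)) (s⊑s′ : lookup s ⊑ lookup s′)
               (glue : ∀ Q → Closed s Q → Q a ≡ Q b → Closed s′ Q)
               (a~b : lookup (comp G s′ a) b ≡ true) where

    comp-unchanged : lookup (comp G s a) b ≡ true → ∀ w x → lookup (comp G s′ w) x ≡ lookup (comp G s w) x
    comp-unchanged ab w x = ≡true-ext
      (comp-least s′ w (lookup (comp G s w))
         (glue _ (comp-closed s w) (Closed-const s (lookup (comp G s w)) a b (comp-closed s w) ab))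
         (comp-refl s w) x)
      (comp-mono s s′ w s⊑s′ x)

    ncomp-unchanged : lookup (comp G s a) b ≡ true → ncomp s′ ≡ ncomp s
    ncomp-unchanged ab = count-cong (allFin (nv G)) (λ w → sym (isRep-cong s s′ w (λ x → sym (comp-unchanged ab w x))))

    module Bridge (a≁b : lookup (comp G s a) b ≡ false) where

      comp-away : ∀ w → lookup (comp G s a) w ≡ false → lookup (comp G s b) w ≡ false →
                  ∀ x → lookup (comp G s′ w) x ≡ lookup (comp G s w) x
      comp-away w aw bw x = ≡true-ext
        (comp-least s′ w (lookup (comp G s w))
           (glue _ (comp-closed s w) (trans (apart a aw) (sym (apart b bw))))
           (comp-refl s w) x)
        (comp-mono s s′ w s⊑s′ x)
        where
        apart : ∀ c → lookup (comp G s c) w ≡ false → lookup (comp G s w) c ≡ false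
        apart c cw with lookup (comp G s w) c in wc
        ... | false = refl
        ... | true  = ⊥-elim (true≢false (trans (sym (comp-sym s w c wc)) cw))

      merged : Fin (nv G) → Bool
      merged x = lookup (comp G s a) x ∨ lookup (comp G s b) x

      merged-a : merged a ≡ true
      merged-a rewrite comp-refl s a = refl

      merged-b : merged b ≡ true
      merged-b rewrite comp-refl s b = ∨-zeroʳ _

      comp-merged : ∀ w → merged w ≡ true → ∀ x → lookup (comp G s′ w) x ≡ merged x
      comp-merged w mw x = ≡true-ext
        (comp-least s′ w merged
           (glue merged (λ k sk → cong₂ _∨_ (comp-closed s a k sk) (comp-closed s b k sk))
                        (trans merged-a (sym merged-b)))
           mw x)
        (λ mx → [ comp-trans s′ w a x w~a ∘ comp-mono s s′ a s⊑s′ x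
                , comp-trans s′ w b x w~b ∘ comp-mono s s′ b s⊑s′ x ] (∨-true⁻ mx))
        where
        w~a : lookup (comp G s′ w) a ≡ true
        w~a with ∨-true⁻ mw
        ... | inj₁ aw = comp-mono s s′ w s⊑s′ a (comp-sym s a w aw)
        ... | inj₂ bw = comp-trans s′ w b a (comp-mono s s′ w s⊑s′ b (comp-sym s b w bw)) (comp-sym s′ a b a~b)
        w~b : lookup (comp G s′ w) b ≡ true
        w~b = comp-trans s′ w a b w~a a~b

      module Ordered (ra rb : Fin (nv G)) (ra-rep : Representative s a ra) (rb-rep : Representative s b rb)
                     (ra<rb : toℕ ra < toℕ rb) where

        a~ra : lookup (comp G s a) ra ≡ true
        a~ra = proj₁ ra-rep
        b~rb : lookup (comp G s b) rb ≡ true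
        b~rb = proj₁ rb-rep
        ra-least : ∀ x → lookup (comp G s a) x ≡ true → toℕ ra ≤ toℕ x
        ra-least = proj₂ (proj₂ ra-rep)
        rb-least : ∀ x → lookup (comp G s b) x ≡ true → toℕ rb ≤ toℕ x
        rb-least = proj₂ (proj₂ rb-rep)

        merged-ra : merged ra ≡ true
        merged-ra rewrite a~ra = refl

        merged-rb : merged rb ≡ true
        merged-rb rewrite b~rb = ∨-zeroʳ _

        rb-not-isRep : isRep G s′ rb ≡ false
        rb-not-isRep = isRep-false⁺ s′ rb ra ra<rb (trans (comp-merged rb merged-rb ra) merged-ra)

        ra-isRep : isRep G s ra ≡ isRep G s′ ra
        ra-isRep = trans (proj₁ (proj₂ ra-rep)) (sym (isRep-true⁺ s′ ra λ x rx →
          [ ra-least x , (λ bx → ℕₚ.<⇒≤ (ℕₚ.<-≤-trans ra<rb (rb-least x bx))) ]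
          (∨-true⁻ (trans (sym (comp-merged ra merged-ra x)) rx))))

        non-least : ∀ w r → toℕ r ≤ toℕ w → w ≢ r → lookup (comp G s w) r ≡ true → merged r ≡ true →
                    merged w ≡ true → isRep G s w ≡ isRep G s′ w
        non-least w r r≤w w≢r wr mr mw =
          let r<w = ℕₚ.≤∧≢⇒< r≤w (λ eq → w≢r (sym (Finₚ.toℕ-injective eq)))
          in trans (isRep-false⁺ s w r r<w wr) (sym (isRep-false⁺ s′ w r r<w (trans (comp-merged w mw r) mr)))

        isRep-kept : ∀ w → w ≢ rb → isRep G s w ≡ isRep G s′ w
        isRep-kept w w≢rb with lookup (comp G s a) w in aw | lookup (comp G s b) w in bw
        ... | false | false = isRep-cong s s′ w (λ x → sym (comp-away w aw bw x))
        ... | false | true  = non-least w rb (rb-least w bw) w≢rb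
                                (comp-trans s w b rb (comp-sym s b w bw) b~rb) merged-rb
                                (trans (cong (lookup (comp G s a) w ∨_) bw) (∨-zeroʳ _))
        ... | true  | _ with w Finₚ.≟ ra
        ...   | yes refl = ra-isRep
        ...   | no  w≢ra = non-least w ra (ra-least w aw) w≢ra
                             (comp-trans s w a ra (comp-sym s a w aw) a~ra) merged-ra
                             (cong (_∨ lookup (comp G s b) w) aw)

        ncomp-drops : ncomp s ≡ suc (ncomp s′)
        ncomp-drops = count-tabulate-suc id (isRep G s) (isRep G s′) rb (proj₁ (proj₂ rb-rep)) rb-not-isRep isRep-kept

  ncomp-∪⁅⁆-cycle : ∀ s e → lookup (comp G s (src G e)) (tgt G e) ≡ true → ncomp (s ∪ ⁅ e ⁆) ≡ ncomp s
  ncomp-∪⁅⁆-cycle s e = Merge.ncomp-unchanged s (s ∪ ⁅ e ⁆) (src G e) (tgt G e) (⊑-∪⁅⁆ s e)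
    (λ Q c → Closed-∪⁅⁆ s e Q c) (comp-tgt (s ∪ ⁅ e ⁆) e (∈-∪⁅⁆ s e))

  ncomp-∪⁅⁆-bridge : ∀ s e → lookup (comp G s (src G e)) (tgt G e) ≡ false →
                     ncomp s ≡ suc (ncomp (s ∪ ⁅ e ⁆))
  ncomp-∪⁅⁆-bridge s e u≁v = by-order (representative s u) (representative s v)
    where
    u v : Fin (nv G)
    u = src G e
    v = tgt G e
    s′ : Subset (ne G)
    s′ = s ∪ ⁅ e ⁆
    v≁u : lookup (comp G s v) u ≡ false
    v≁u with lookup (comp G s v) u in vu
    ... | false = refl
    ... | true  = ⊥-elim (true≢false (trans (sym (comp-sym s v u vu)) u≁v))
    by-order : Σ _ (Representative s u) → Σ _ (Representative s v) → ncomp s ≡ suc (ncomp s′)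
    by-order (ru , ru-rep) (rv , rv-rep) with ℕₚ.<-cmp (toℕ ru) (toℕ rv)
    ... | tri< ru<rv _ _ =
      Merge.Bridge.Ordered.ncomp-drops s s′ u v (⊑-∪⁅⁆ s e) (λ Q c → Closed-∪⁅⁆ s e Q c)
        (comp-tgt s′ e (∈-∪⁅⁆ s e)) u≁v ru rv ru-rep rv-rep ru<rv
    ... | tri> _ _ rv<ru =
      Merge.Bridge.Ordered.ncomp-drops s s′ v u (⊑-∪⁅⁆ s e) (λ Q c q → Closed-∪⁅⁆ s e Q c (sym q))
        (comp-src s′ e (∈-∪⁅⁆ s e)) v≁u rv ru rv-rep ru-rep rv<ru
    ... | tri≈ _ ru≡rv _ = ⊥-elim (true≢false (trans (sym u~v) u≁v))
      where
      u~v : lookup (comp G s u) v ≡ true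
      u~v = comp-trans s u ru v (proj₁ ru-rep)
              (comp-sym s v ru (subst (λ r → lookup (comp G s v) r ≡ true)
                                      (sym (Finₚ.toℕ-injective ru≡rv)) (proj₁ rv-rep)))

  ncomp-⊥ : ncomp ⊥ ≡ nv G
  ncomp-⊥ = countF-all (isRep G ⊥) (λ v → isolated⇒isRep ⊥ v λ e e∈⊥ →
    ⊥-elim (true≢false (trans (sym e∈⊥) (lookup-⊥ e))))

  ncomp-∪⁅⁆-≤ : ∀ s e → ncomp s ≤ suc (ncomp (s ∪ ⁅ e ⁆))
  ncomp-∪⁅⁆-≤ s e with lookup (comp G s (src G e)) (tgt G e) in u~v
  ... | true  = ℕₚ.≤-trans (ℕₚ.≤-reflexive (sym (ncomp-∪⁅⁆-cycle s e u~v))) (ℕₚ.n≤1+n _)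
  ... | false = ℕₚ.≤-reflexive (ncomp-∪⁅⁆-bridge s e u~v)

  -- That is, b₁ ≥ 0: the truncated subtraction in b1 never truncates.
  nv≤∣s∣+ncomp : ∀ s → nv G ≤ ∣ s ∣ ℕ.+ ncomp s
  nv≤∣s∣+ncomp s = by-size ∣ s ∣ s refl
    where
    by-size : ∀ k s → ∣ s ∣ ≡ k → nv G ≤ ∣ s ∣ ℕ.+ ncomp s
    by-size zero    s ∣s∣≡0 rewrite ∣s∣≡0⇒s≡⊥ s ∣s∣≡0 | Subsetₚ.∣⊥∣≡0 (ne G) =
      ℕₚ.≤-reflexive (sym ncomp-⊥)
    by-size (suc k) s ∣s∣≡1+k with ∣s∣≡suc⇒∈ s ∣s∣≡1+k
    ... | e , se = subst (λ t → nv G ≤ ∣ t ∣ ℕ.+ ncomp t) (delete-∪⁅⁆ s e se) (begin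
        nv G                             ≤⟨ by-size k s₀ ∣s₀∣≡k ⟩
        ∣ s₀ ∣ ℕ.+ ncomp s₀              ≤⟨ ℕₚ.+-monoʳ-≤ ∣ s₀ ∣ (ncomp-∪⁅⁆-≤ s₀ e) ⟩
        ∣ s₀ ∣ ℕ.+ suc (ncomp s₁)        ≡⟨ ℕₚ.+-suc ∣ s₀ ∣ _ ⟩
        suc ∣ s₀ ∣ ℕ.+ ncomp s₁          ≡⟨ cong (ℕ._+ ncomp s₁) (sym ∣s₁∣) ⟩
        ∣ s₁ ∣ ℕ.+ ncomp s₁              ∎)
      where
      open ℕₚ.≤-Reasoning
      s₀ s₁ : Subset (ne G)
      s₀ = delete s e
      s₁ = s₀ ∪ ⁅ e ⁆
      ∣s₁∣ : ∣ s₁ ∣ ≡ suc ∣ s₀ ∣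
      ∣s₁∣ = ∣∪⁅⁆∣ s₀ e (lookup-delete s e)
      ∣s₀∣≡k : ∣ s₀ ∣ ≡ k
      ∣s₀∣≡k = ℕₚ.suc-injective (trans (sym ∣s₁∣) (trans (cong ∣_∣ (delete-∪⁅⁆ s e se)) ∣s∣≡1+k))

  -- Betti numbers and basis elements

  b0-full : ∀ s → b0 (fullG G) s ≡ ncomp s
  b0-full s = count-cong (allFin (nv G)) (λ v → cong (_∧ isRep G s v) (lookup-⊤ v))

  b1-full : ∀ s → b1 (fullG G) s ≡ (∣ s ∣ ℕ.+ ncomp s) ∸ nv G
  b1-full s = cong₂ (λ c n → (∣ s ∣ ℕ.+ c) ∸ n) (b0-full s) (Subsetₚ.∣⊤∣≡n (nv G))

  outside⇒isRep : ∀ (H : SubG G) s → lookup s ⊑ lookup (ES H) →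
                  ∀ v → lookup (VS H) v ≡ false → isRep G s v ≡ true
  outside⇒isRep H s s⊑E v v∉H = isolated⇒isRep s v λ e se →
    let (src∈H , tgt∈H) = closed H e (s⊑E e se) in ∈H⇒≢ src∈H , ∈H⇒≢ tgt∈H
    where
    ∈H⇒≢ : ∀ {x} → lookup (VS H) x ≡ true → x ≢ v
    ∈H⇒≢ x∈H refl = true≢false (trans (sym x∈H) v∉H)

  -- The vertices outside H are isolated in [G : s]: they add as many components as vertices.
  b1-sub : ∀ (H : SubG G) s → lookup s ⊑ lookup (ES H) → b1 H s ≡ b1 (fullG G) s
  b1-sub H s s⊑E = sym (begin
      b1 (fullG G) s
        ≡⟨ b1-full s ⟩
      (∣ s ∣ ℕ.+ ncomp s) ∸ nv G
        ≡⟨ cong₂ (λ c n → (∣ s ∣ ℕ.+ c) ∸ n) split (sym (∣p∣+∣∁p∣ (VS H))) ⟩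
      (∣ s ∣ ℕ.+ (b0 H s ℕ.+ m)) ∸ (∣ VS H ∣ ℕ.+ m)
        ≡⟨ cong (_∸ (∣ VS H ∣ ℕ.+ m)) (sym (ℕₚ.+-assoc ∣ s ∣ _ m)) ⟩
      ((∣ s ∣ ℕ.+ b0 H s) ℕ.+ m) ∸ (∣ VS H ∣ ℕ.+ m)
        ≡⟨ cong₂ _∸_ (ℕₚ.+-comm _ m) (ℕₚ.+-comm _ m) ⟩
      (m ℕ.+ (∣ s ∣ ℕ.+ b0 H s)) ∸ (m ℕ.+ ∣ VS H ∣)
        ≡⟨ ℕₚ.[m+n]∸[m+o]≡n∸o m _ _ ⟩
      (∣ s ∣ ℕ.+ b0 H s) ∸ ∣ VS H ∣ ∎)
    where
    open ≡-Reasoning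
    m : ℕ
    m = countF (not ∘ lookup (VS H))
    split : ncomp s ≡ b0 H s ℕ.+ m
    split = trans (count-split (allFin (nv G)) (isRep G s) (lookup (VS H)))
      (cong₂ ℕ._+_ (count-cong (allFin (nv G)) (λ v → ∧-comm (isRep G s v) _))
                   (count-cong (allFin (nv G)) outside))
      where
      outside : ∀ v → isRep G s v ∧ not (lookup (VS H) v) ≡ not (lookup (VS H) v)
      outside v with lookup (VS H) v in v∈H
      ... | true  = ∧-zeroʳ _
      ... | false = trans (∧-identityʳ _) (outside⇒isRep H s s⊑E v v∈H)

  b1-∪⁅⁆-cycle : ∀ s e → lookup s e ≡ false → lookup (comp G s (src G e)) (tgt G e) ≡ true →
                 b1 (fullG G) (s ∪ ⁅ e ⁆) ≡ suc (b1 (fullG G) s)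
  b1-∪⁅⁆-cycle s e e∉s u~v = begin
    b1 (fullG G) (s ∪ ⁅ e ⁆)
      ≡⟨ b1-full (s ∪ ⁅ e ⁆) ⟩
    (∣ s ∪ ⁅ e ⁆ ∣ ℕ.+ ncomp (s ∪ ⁅ e ⁆)) ∸ nv G
      ≡⟨ cong₂ (λ a c → (a ℕ.+ c) ∸ nv G) (∣∪⁅⁆∣ s e e∉s) (ncomp-∪⁅⁆-cycle s e u~v) ⟩
    (suc ∣ s ∣ ℕ.+ ncomp s) ∸ nv G
      ≡⟨ ℕₚ.+-∸-assoc 1 (nv≤∣s∣+ncomp s) ⟩
    suc ((∣ s ∣ ℕ.+ ncomp s) ∸ nv G)
      ≡⟨ cong suc (sym (b1-full s)) ⟩
    suc (b1 (fullG G) s) ∎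
    where open ≡-Reasoning

  b1-∪⁅⁆-bridge : ∀ s e → lookup s e ≡ false → lookup (comp G s (src G e)) (tgt G e) ≡ false →
                  b1 (fullG G) (s ∪ ⁅ e ⁆) ≡ b1 (fullG G) s
  b1-∪⁅⁆-bridge s e e∉s u≁v = begin
    b1 (fullG G) (s ∪ ⁅ e ⁆)
      ≡⟨ b1-full (s ∪ ⁅ e ⁆) ⟩
    (∣ s ∪ ⁅ e ⁆ ∣ ℕ.+ ncomp (s ∪ ⁅ e ⁆)) ∸ nv G
      ≡⟨ cong (λ a → (a ℕ.+ ncomp (s ∪ ⁅ e ⁆)) ∸ nv G) (∣∪⁅⁆∣ s e e∉s) ⟩
    (suc ∣ s ∣ ℕ.+ ncomp (s ∪ ⁅ e ⁆)) ∸ nv G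
      ≡⟨ cong (_∸ nv G) (sym (ℕₚ.+-suc ∣ s ∣ _)) ⟩
    (∣ s ∣ ℕ.+ suc (ncomp (s ∪ ⁅ e ⁆))) ∸ nv G
      ≡⟨ cong (λ c → (∣ s ∣ ℕ.+ c) ∸ nv G) (sym (ncomp-∪⁅⁆-bridge s e u≁v)) ⟩
    (∣ s ∣ ℕ.+ ncomp s) ∸ nv G
      ≡⟨ sym (b1-full s) ⟩
    b1 (fullG G) s ∎
    where open ≡-Reasoning

  withinᵇ : SubG G → Idx G → Bool
  withinᵇ K (s , X , _) = subsetᵇ s (ES K) ∧ subsetᵇ X (VS K)

  within⁻ : ∀ K s X w → withinᵇ K (s , X , w) ≡ true → (lookup s ⊑ lookup (ES K)) × (lookup X ⊑ lookup (VS K))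
  within⁻ K s X w h = let (s⊑E , X⊑V) = ∧-true⁻ h in subsetᵇ⁻ s (ES K) s⊑E , subsetᵇ⁻ X (VS K) X⊑V

  within⁺ : ∀ K s X w → lookup s ⊑ lookup (ES K) → lookup X ⊑ lookup (VS K) → withinᵇ K (s , X , w) ≡ true
  within⁺ K s X w s⊑E X⊑V rewrite subsetᵇ⁺ s (ES K) s⊑E | subsetᵇ⁺ X (VS K) X⊑V = refl

  validᵇ-split : ∀ (H : SubG G) y → validᵇ H y ≡ validᵇ (fullG G) y ∧ withinᵇ H y
  validᵇ-split H (s , X , w) rewrite subsetᵇ-⊤ s | subsetᵇ-⊤ X with subsetᵇ s (ES H) in s⊑E
  ... | false = sym (∧-zeroʳ _)
  ... | true rewrite b1-sub H s (subsetᵇ⁻ s (ES H) s⊑E) with subsetᵇ X (VS H)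
  ...   | false = sym (∧-zeroʳ _)
  ...   | true  = sym (∧-identityʳ _)

  valid⇒within : ∀ (K : SubG G) y → validᵇ K y ≡ true → withinᵇ K y ≡ true
  valid⇒within K y y-valid = proj₂ (∧-true⁻ {validᵇ (fullG G) y} (trans (sym (validᵇ-split K y)) y-valid))

  closedᵇ : Subset (ne G) → Subset (nv G) → Bool
  closedᵇ s X = all (λ e → not (lookup s e) ∨
                           ((lookup X (src G e) ∧ lookup X (tgt G e)) ∨
                            (not (lookup X (src G e)) ∧ not (lookup X (tgt G e)))))
                    (allFin (ne G))

  closedᵇ⁻ : ∀ s X → closedᵇ s X ≡ true → Closed s (lookup X)
  closedᵇ⁻ s X h e se = same-ends (lookup s e) _ _ (all-allFin⁻ _ h e) se
    where
    same-ends : ∀ a x y → not a ∨ ((x ∧ y) ∨ (not x ∧ not y)) ≡ true → a ≡ true → x ≡ y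
    same-ends true true  true  _ _ = refl
    same-ends true false false _ _ = refl

  closedᵇ⁺ : ∀ s X → Closed s (lookup X) → closedᵇ s X ≡ true
  closedᵇ⁺ s X c = all-allFin⁺ _ (λ e → same-ends (lookup s e) _ _ (c e))
    where
    same-ends : ∀ a x y → (a ≡ true → x ≡ y) → not a ∨ ((x ∧ y) ∨ (not x ∧ not y)) ≡ true
    same-ends false x y _ = refl
    same-ends true  x y h with h refl
    same-ends true true  .true  _ | refl = refl
    same-ends true false .false _ | refl = refl

  validᵇ⇒length : ∀ (H : SubG G) s X w → validᵇ H (s , X , w) ≡ true → length w ≡ b1 H s
  validᵇ⇒length H s X w h =
    ≟-true⁻ (proj₂ (∧-true⁻ {closedᵇ s X}
      (proj₂ (∧-true⁻ {subsetᵇ X (VS H)} (proj₂ (∧-true⁻ {subsetᵇ s (ES H)} h))))))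

  validᵇ-full⁻ : ∀ s X w → validᵇ (fullG G) (s , X , w) ≡ true →
                 Closed s (lookup X) × (length w ≡ b1 (fullG G) s)
  validᵇ-full⁻ s X w h rewrite subsetᵇ-⊤ s | subsetᵇ-⊤ X =
    let (c , l) = ∧-true⁻ h in closedᵇ⁻ s X c , ≟-true⁻ l

  validᵇ-full⁺ : ∀ s X w → Closed s (lookup X) → length w ≡ b1 (fullG G) s →
                 validᵇ (fullG G) (s , X , w) ≡ true
  validᵇ-full⁺ s X w c l rewrite subsetᵇ-⊤ s | subsetᵇ-⊤ X | closedᵇ⁺ s X c | ≟-true⁺ l = refl

  record Extends (b : Idx G) (e : Fin (ne G)) (b′ : Idx G) : Set where
    field
      edge-added : lookup (proj₁ b′) e ≡ true
      edges-grow : lookup (proj₁ b) ⊑ lookup (proj₁ b′)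
      marks-grow : lookup (proj₁ (proj₂ b)) ⊑ lookup (proj₁ (proj₂ b′))
      valid      : validᵇ (fullG G) b ≡ true → lookup (proj₁ b) e ≡ false → validᵇ (fullG G) b′ ≡ true
      within     : ∀ K → withinᵇ K b ≡ true → lookup (ES K) e ≡ true → withinᵇ K b′ ≡ true

  extends-keep : ∀ s X w e w′ → (Closed s (lookup X) → lookup X (src G e) ≡ lookup X (tgt G e)) →
    (length w ≡ b1 (fullG G) s → lookup s e ≡ false → length w′ ≡ b1 (fullG G) (s ∪ ⁅ e ⁆)) →
    Extends (s , X , w) e (s ∪ ⁅ e ⁆ , X , w′)
  extends-keep s X w e w′ same-ends lengths = record
    { edge-added = ∈-∪⁅⁆ s e
    ; edges-grow = ⊑-∪⁅⁆ s e
    ; marks-grow = λ _ h → h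
    ; valid      = λ b-valid e∉s → let (c , l) = validᵇ-full⁻ s X w b-valid in
        validᵇ-full⁺ (s ∪ ⁅ e ⁆) X w′ (Closed-∪⁅⁆ s e (lookup X) c (same-ends c)) (lengths l e∉s)
    ; within     = λ K w∈K e∈K → let (s⊑E , X⊑V) = within⁻ K s X w w∈K in
        within⁺ K (s ∪ ⁅ e ⁆) X w′ (∪⁅⁆-⊑ s (ES K) e s⊑E e∈K) X⊑V
    }

  extends-merge : ∀ s X w e → lookup (comp G s (src G e)) (tgt G e) ≡ false →
    Extends (s , X , w) e (s ∪ ⁅ e ⁆ , X ∪ (comp G s (src G e) ∪ comp G s (tgt G e)) , w)
  extends-merge s X w e u≁v = record
    { edge-added = ∈-∪⁅⁆ s e
    ; edges-grow = ⊑-∪⁅⁆ s e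
    ; marks-grow = λ x h → trans (lookup-X′ x) (cong (_∨ (lookup (comp G s u) x ∨ lookup (comp G s v) x)) h)
    ; valid      = λ b-valid e∉s → let (c , l) = validᵇ-full⁻ s X w b-valid in
        validᵇ-full⁺ (s ∪ ⁅ e ⁆) X′ w
          (Closed-resp (s ∪ ⁅ e ⁆) (sym ∘ lookup-X′)
            (Closed-∪⁅⁆ s e marked
              (λ k sk → cong₂ _∨_ (c k sk) (cong₂ _∨_ (comp-closed s u k sk) (comp-closed s v k sk)))
              (trans marked-u (sym marked-v))))
          (trans l (sym (b1-∪⁅⁆-bridge s e e∉s u≁v)))
    ; within     = λ K w∈K e∈K → let (s⊑E , X⊑V) = within⁻ K s X w w∈K in
        within⁺ K (s ∪ ⁅ e ⁆) X′ w (∪⁅⁆-⊑ s (ES K) e s⊑E e∈K)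
          (λ x h → marked⊑V K s⊑E X⊑V e∈K x (trans (sym (lookup-X′ x)) h))
    }
    where
    u v : Fin (nv G)
    u = src G e
    v = tgt G e
    X′ : Subset (nv G)
    X′ = X ∪ (comp G s u ∪ comp G s v)
    marked : Fin (nv G) → Bool
    marked x = lookup X x ∨ (lookup (comp G s u) x ∨ lookup (comp G s v) x)
    lookup-X′ : ∀ x → lookup X′ x ≡ marked x
    lookup-X′ x = trans (lookup-∪ X _ x) (cong (lookup X x ∨_) (lookup-∪ (comp G s u) (comp G s v) x))
    marked-u : marked u ≡ true
    marked-u rewrite comp-refl s u = ∨-zeroʳ _
    marked-v : marked v ≡ true
    marked-v rewrite comp-refl s v = trans (cong (lookup X v ∨_) (∨-zeroʳ _)) (∨-zeroʳ _)
    marked⊑V : ∀ K → lookup s ⊑ lookup (ES K) → lookup X ⊑ lookup (VS K) → lookup (ES K) e ≡ true →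
               marked ⊑ lookup (VS K)
    marked⊑V K s⊑E X⊑V e∈K x h with ∨-true⁻ h
    ... | inj₁ x∈X = X⊑V x x∈X
    ... | inj₂ x∈C = [ comp-least s u (lookup (VS K)) K-closed (proj₁ (closed K e e∈K)) x
                     , comp-least s v (lookup (VS K)) K-closed (proj₂ (closed K e e∈K)) x ] (∨-true⁻ x∈C)
      where
      K-closed : Closed s (lookup (VS K))
      K-closed k sk = let (src∈ , tgt∈) = closed K k (s⊑E k sk) in trans src∈ (sym tgt∈)

  dEdge-shape : ∀ (H : SubG G) s X w e → (dEdge H (s , X , w) e ≡ []) ⊎
    (Σ[ ε ∈ ℤ ] Σ[ b′ ∈ Idx G ] (dEdge H (s , X , w) e ≡ (ε , b′) ∷ []) × Extends (s , X , w) e b′)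
  dEdge-shape H s X w e
    with lookup (comp G s (src G e)) (tgt G e) in u~v | lookup X (src G e) in Xu | lookup X (tgt G e) in Xv
  ... | true  | _     | _     = inj₂ (_ , _ , refl , extends-keep s X w e (w ++ false ∷ [])
      (λ c → Closed-const s (lookup X) _ _ c u~v)
      (λ l e∉s → trans (Listₚ.length-++ w) (trans (ℕₚ.+-comm (length w) 1)
                   (trans (cong suc l) (sym (b1-∪⁅⁆-cycle s e e∉s u~v))))))
  ... | false | true  | true  = inj₁ refl
  ... | false | false | false = inj₂ (_ , _ , refl , extends-keep s X w e w
      (λ _ → trans Xu (sym Xv))
      (λ l e∉s → trans l (sym (b1-∪⁅⁆-bridge s e e∉s u~v))))
  ... | false | true  | false = inj₂ (_ , _ , refl , extends-merge s X w e u~v)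
  ... | false | false | true  = inj₂ (_ , _ , refl , extends-merge s X w e u~v)

  eqIdx⇒≡ : ∀ (a b : Idx G) → eqIdx {G = G} a b ≡ true → a ≡ b
  eqIdx⇒≡ (s , X , w) (s′ , X′ , w′) h
    with Vecₚ.≡-dec Bool._≟_ s s′ | Vecₚ.≡-dec Bool._≟_ X X′ | Listₚ.≡-dec Bool._≟_ w w′
  eqIdx⇒≡ _ _ _  | yes refl | yes refl | yes refl = refl
  eqIdx⇒≡ _ _ () | no _     | _        | _
  eqIdx⇒≡ _ _ () | yes _    | no _     | _
  eqIdx⇒≡ _ _ () | yes _    | yes _    | no _

  eqIdx-refl : ∀ (a : Idx G) → eqIdx {G = G} a a ≡ true
  eqIdx-refl (s , X , w)
    with Vecₚ.≡-dec Bool._≟_ s s | Vecₚ.≡-dec Bool._≟_ X X | Listₚ.≡-dec Bool._≟_ w w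
  ... | yes _    | yes _    | yes _    = refl
  ... | no  s≢s  | _        | _        = ⊥-elim (s≢s refl)
  ... | yes _    | no  X≢X  | _        = ⊥-elim (X≢X refl)
  ... | yes _    | yes _    | no  w≢w  = ⊥-elim (w≢w refl)

  ≢⇒eqIdx-false : ∀ (a b : Idx G) → a ≢ b → eqIdx {G = G} a b ≡ false
  ≢⇒eqIdx-false a b a≢b with eqIdx {G = G} a b in ab
  ... | false = refl
  ... | true  = ⊥-elim (a≢b (eqIdx⇒≡ a b ab))

  coeff : Idx G → ℤ × Idx G → ℤ
  coeff y t = if eqIdx {G = G} (proj₂ t) y then proj₁ t else 0ℤ

  -- basis H is filterᵇ (validᵇ H) (candidates H) by definition.
  candidates : SubG G → List (Idx G)
  candidates H = concatMap (λ s → concatMap (λ X → map (λ w → s , X , toList w) (allVecs (b1 H s)))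
                                            (allVecs (nv G)))
                           (allVecs (ne G))

  ∑-basis : ∀ (H : SubG G) (g : Idx G → ℤ) →
    ∑ (basis H) g ≡ ∑ (allVecs (ne G)) λ s → ∑ (allVecs (nv G)) λ X → ∑ (allVecs (b1 H s)) λ w →
                      if validᵇ H (s , X , toList w) then g (s , X , toList w) else 0ℤ
  ∑-basis H g =
    trans (∑-filterᵇ (validᵇ H) (candidates H) g)
    (trans (∑-concatMap _ (allVecs (ne G)) g′)
      (∑-cong (allVecs (ne G)) λ s → trans (∑-concatMap _ (allVecs (nv G)) g′)
        (∑-cong (allVecs (nv G)) λ X → ∑-map (λ w → s , X , toList w) (allVecs (b1 H s)) g′)))
    where
    g′ : Idx G → ℤ
    g′ b = if validᵇ H b then g b else 0ℤ

  ∑-basis-cong : ∀ (H : SubG G) {f g : Idx G → ℤ} → (∀ b → validᵇ H b ≡ true → f b ≡ g b) →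
                 ∑ (basis H) f ≡ ∑ (basis H) g
  ∑-basis-cong H {f} {g} f≗g = trans (∑-filterᵇ (validᵇ H) (candidates H) f)
    (trans (∑-cong (candidates H) on-valid) (sym (∑-filterᵇ (validᵇ H) (candidates H) g)))
    where
    on-valid : ∀ b → (if validᵇ H b then f b else 0ℤ) ≡ (if validᵇ H b then g b else 0ℤ)
    on-valid b with validᵇ H b in vb
    ... | true  = f≗g b vb
    ... | false = refl

  ∑-basis-single : ∀ (H : SubG G) (g : Idx G → ℤ) y → (∀ b → eqIdx {G = G} b y ≡ false → g b ≡ 0ℤ) →
                   ∑ (basis H) g ≡ (if validᵇ H y then g y else 0ℤ)
  ∑-basis-single H g y@(s₀ , X₀ , w₀) off = begin
    ∑ (basis H) g
      ≡⟨ ∑-basis H g ⟩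
    ∑ (allVecs (ne G)) (λ s → ∑ (allVecs (nv G)) (λ X → ∑ (allVecs (b1 H s)) (g′ s X ∘ toList)))
      ≡⟨ ∑-allVecs-single (ne G) _ s₀ (λ s s≢ → ∑-zero (allVecs (nv G)) λ X →
           ∑-zero (allVecs (b1 H s)) λ w → off′ (s , X , toList w) (s≢ ∘ cong proj₁)) ⟩
    ∑ (allVecs (nv G)) (λ X → ∑ (allVecs (b1 H s₀)) (g′ s₀ X ∘ toList))
      ≡⟨ ∑-allVecs-single (nv G) _ X₀ (λ X X≢ → ∑-zero (allVecs (b1 H s₀)) λ w →
           off′ (s₀ , X , toList w) (X≢ ∘ cong (proj₁ ∘ proj₂))) ⟩
    ∑ (allVecs (b1 H s₀)) (g′ s₀ X₀ ∘ toList)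
      ≡⟨ ∑-allVecs-toList-single (b1 H s₀) (g′ s₀ X₀) w₀ (λ w w≢ →
           off′ (s₀ , X₀ , w) (w≢ ∘ cong (proj₂ ∘ proj₂))) ⟩
    (if ⌊ length w₀ ℕ.≟ b1 H s₀ ⌋ then g′ s₀ X₀ w₀ else 0ℤ)
      ≡⟨ length-redundant (validᵇ H y) (λ vy → ≟-true⁺ (validᵇ⇒length H s₀ X₀ w₀ vy)) ⟩
    (if validᵇ H y then g y else 0ℤ) ∎
    where
    open ≡-Reasoning
    g′ : Subset (ne G) → Subset (nv G) → List Bool → ℤ
    g′ s X w = if validᵇ H (s , X , w) then g (s , X , w) else 0ℤ
    off′ : ∀ b → b ≢ y → (if validᵇ H b then g b else 0ℤ) ≡ 0ℤ
    off′ b b≢y = if-0 (validᵇ H b) (off b (≢⇒eqIdx-false b y b≢y))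
    length-redundant : ∀ v → (v ≡ true → ⌊ length w₀ ℕ.≟ b1 H s₀ ⌋ ≡ true) →
      (if ⌊ length w₀ ℕ.≟ b1 H s₀ ⌋ then (if v then g y else 0ℤ) else 0ℤ) ≡ (if v then g y else 0ℤ)
    length-redundant false _ with ⌊ length w₀ ℕ.≟ b1 H s₀ ⌋
    ... | true  = refl
    ... | false = refl
    length-redundant true  l rewrite l refl = refl

  ∑-basis-restrict : ∀ (K : SubG G) (g : Idx G → ℤ) →
                     ∑ (basis K) g ≡ ∑ (basis (fullG G)) (λ b → if validᵇ K b then g b else 0ℤ)
  ∑-basis-restrict K g = trans (∑-basis K g)
    (trans (∑-cong (allVecs (ne G)) λ s → ∑-cong (allVecs (nv G)) λ X → per-edge-set s X (subsetᵇ s (ES K)) refl)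
           (sym (∑-basis (fullG G) _)))
    where
    g′ : Idx G → ℤ
    g′ b = if validᵇ K b then g b else 0ℤ
    valid-in-full : ∀ b → g′ b ≡ (if validᵇ (fullG G) b then g′ b else 0ℤ)
    valid-in-full b rewrite validᵇ-split K b with validᵇ (fullG G) b
    ... | true  = refl
    ... | false = refl
    per-edge-set : ∀ s X t → subsetᵇ s (ES K) ≡ t →
      ∑ (allVecs (b1 K s)) (λ w → g′ (s , X , toList w)) ≡
      ∑ (allVecs (b1 (fullG G) s)) (λ w → if validᵇ (fullG G) (s , X , toList w) then g′ (s , X , toList w) else 0ℤ)
    per-edge-set s X true s⊑E =
      trans (cong (λ n → ∑ (allVecs n) (λ w → g′ (s , X , toList w))) (b1-sub K s (subsetᵇ⁻ s (ES K) s⊑E)))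
            (∑-cong (allVecs (b1 (fullG G) s)) (λ w → valid-in-full (s , X , toList w)))
    per-edge-set s X false s⋢E = trans (∑-zero (allVecs (b1 K s)) (λ w → if-false _ (invalid (toList w))))
      (sym (∑-zero (allVecs (b1 (fullG G) s)) λ w →
        if-0 (validᵇ (fullG G) (s , X , toList w)) (if-false _ (invalid (toList w)))))
      where
      invalid : ∀ w → validᵇ K (s , X , w) ≡ false
      invalid w rewrite validᵇ-split K (s , X , w) | s⋢E = ∧-zeroʳ _

  β-apply : ∀ (H K : SubG G) c y → β H K c y ≡ (if validᵇ H y ∧ withinᵇ K y then c y else 0ℤ)
  β-apply H K c y = trans (∑-basis-single H _ y off) (on-diagonal (validᵇ H y) (withinᵇ K y) refl)
    where
    off : ∀ b → eqIdx {G = G} b y ≡ false → c b * ∑ (βBasis K b) (coeff y) ≡ 0ℤ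
    off b b≢y with withinᵇ K b
    ... | true  rewrite b≢y = ℤₚ.*-zeroʳ (c b)
    ... | false = ℤₚ.*-zeroʳ (c b)
    on-diagonal : ∀ v k → withinᵇ K y ≡ k →
      (if v then c y * ∑ (βBasis K y) (coeff y) else 0ℤ) ≡ (if v ∧ k then c y else 0ℤ)
    on-diagonal false _     _  = refl
    on-diagonal true  false wy rewrite wy = ℤₚ.*-zeroʳ (c y)
    on-diagonal true  true  wy rewrite wy | eqIdx-refl y = ℤₚ.*-identityʳ (c y)

  β-full : ∀ (K : SubG G) c y → β (fullG G) K c y ≡ (if validᵇ K y then c y else 0ℤ)
  β-full K c y = trans (β-apply (fullG G) K c y) (cong (λ v → if v then c y else 0ℤ) (sym (validᵇ-split K y)))

  -- β is a chain map

  dCoeff : SubG G → Idx G → Idx G → ℤ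
  dCoeff H b y = ∑ (dBasis H b) (coeff y)

  dCoeff-edges : ∀ (H : SubG G) b y → dCoeff H b y ≡
    ∑ (allFin (ne G)) λ e →
      if lookup (ES H) e ∧ not (lookup (proj₁ b) e) then ∑ (dEdge H b e) (coeff y) else 0ℤ
  dCoeff-edges H b y = trans (∑-concatMap _ (allFin (ne G)) (coeff y))
    (∑-cong (allFin (ne G)) λ e → ∑-if (lookup (ES H) e ∧ not (lookup (proj₁ b) e)) (dEdge H b e) (coeff y))

  dEdge-coeff : ∀ (H : SubG G) s X w e y → (∑ (dEdge H (s , X , w) e) (coeff y) ≡ 0ℤ) ⊎ Extends (s , X , w) e y
  dEdge-coeff H s X w e y with dEdge-shape H s X w e
  ... | inj₁ none rewrite none = inj₁ refl
  ... | inj₂ (ε , b′ , single , ext) rewrite single with eqIdx {G = G} b′ y in b′≡y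
  ...   | false = inj₁ refl
  ...   | true  = inj₂ (subst (Extends (s , X , w) e) (eqIdx⇒≡ b′ y b′≡y) ext)

  -- The terms of d b only grow the edge set and the marked vertices.
  dCoeff-outside : ∀ (H K : SubG G) s X w y → withinᵇ K y ≡ true → withinᵇ K (s , X , w) ≡ false →
                   dCoeff H (s , X , w) y ≡ 0ℤ
  dCoeff-outside H K s X w y@(sy , Xy , wy) y∈K b∉K =
    trans (dCoeff-edges H (s , X , w) y) (∑-zero (allFin (ne G)) λ e → if-0 _ (edge-term e))
    where
    edge-term : ∀ e → ∑ (dEdge H (s , X , w) e) (coeff y) ≡ 0ℤ
    edge-term e with dEdge-coeff H s X w e y
    ... | inj₁ vanishes = vanishes
    ... | inj₂ ext = ⊥-elim (true≢false (trans (sym (within⁺ K s X w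
          (λ i h → s⊑E i (Extends.edges-grow ext i h)) (λ i h → X⊑V i (Extends.marks-grow ext i h)))) b∉K))
      where
      s⊑E : lookup sy ⊑ lookup (ES K)
      s⊑E = proj₁ (within⁻ K sy Xy wy y∈K)
      X⊑V : lookup Xy ⊑ lookup (VS K)
      X⊑V = proj₂ (within⁻ K sy Xy wy y∈K)

  -- dEdge H b e does not depend on H: this is also the edge term of d on C(G).
  edge-term-restrict : ∀ (K : SubG G) s X w e y →
    validᵇ (fullG G) (s , X , w) ≡ true → withinᵇ K (s , X , w) ≡ true → lookup s e ≡ false →
    (if validᵇ K y then ∑ (dEdge K (s , X , w) e) (coeff y) else 0ℤ) ≡
    (if lookup (ES K) e then ∑ (dEdge K (s , X , w) e) (coeff y) else 0ℤ)
  edge-term-restrict K s X w e y@(sy , Xy , wy) b-valid b∈K e∉s with dEdge-coeff K s X w e y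
  ... | inj₁ vanishes rewrite vanishes = trans (if-0 (validᵇ K y) refl) (sym (if-0 (lookup (ES K) e) refl))
  ... | inj₂ ext with lookup (ES K) e in e∈K
  ...   | true  = cong (λ v → if v then _ else 0ℤ)
                    (trans (validᵇ-split K y)
                           (cong₂ _∧_ (Extends.valid ext b-valid e∉s) (Extends.within ext K b∈K e∈K)))
  ...   | false = cong (λ v → if v then _ else 0ℤ) y-invalid
    where
    y-invalid : validᵇ K y ≡ false
    y-invalid with validᵇ K y in y-valid
    ... | false = refl
    ... | true  = ⊥-elim (true≢false (trans (sym e∈K′) e∈K))
      where
      e∈K′ : lookup (ES K) e ≡ true
      e∈K′ = proj₁ (within⁻ K sy Xy wy (valid⇒within K y y-valid)) e (Extends.edge-added ext)

  dCoeff-restrict : ∀ (K : SubG G) s X w y →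
    validᵇ (fullG G) (s , X , w) ≡ true → withinᵇ K (s , X , w) ≡ true →
    (if validᵇ K y then dCoeff (fullG G) (s , X , w) y else 0ℤ) ≡ dCoeff K (s , X , w) y
  dCoeff-restrict K s X w y b-valid b∈K = begin
    (if validᵇ K y then dCoeff (fullG G) b y else 0ℤ)
      ≡⟨ cong (λ t → if validᵇ K y then t else 0ℤ) (dCoeff-edges (fullG G) b y) ⟩
    (if validᵇ K y then ∑ (allFin (ne G)) (term (fullG G)) else 0ℤ)
      ≡⟨ if-∑ (validᵇ K y) (allFin (ne G)) (term (fullG G)) ⟩
    ∑ (allFin (ne G)) (λ e → if validᵇ K y then term (fullG G) e else 0ℤ)
      ≡⟨ ∑-cong (allFin (ne G)) per-edge ⟩
    ∑ (allFin (ne G)) (term K)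
      ≡⟨ sym (dCoeff-edges K b y) ⟩
    dCoeff K b y ∎
    where
    open ≡-Reasoning
    b : Idx G
    b = (s , X , w)
    term : SubG G → Fin (ne G) → ℤ
    term H e = if lookup (ES H) e ∧ not (lookup s e) then ∑ (dEdge H b e) (coeff y) else 0ℤ
    per-edge : ∀ e → (if validᵇ K y then term (fullG G) e else 0ℤ) ≡ term K e
    per-edge e rewrite lookup-⊤ e with lookup s e in e∈s
    ... | true  = trans (if-0 (validᵇ K y) refl) (sym (if-false _ (∧-zeroʳ (lookup (ES K) e))))
    ... | false = trans (edge-term-restrict K s X w e y b-valid b∈K e∈s)
                        (cong (λ v → if v then _ else 0ℤ) (sym (∧-identityʳ (lookup (ES K) e))))

  β-commutes-with-d : ∀ (K : SubG G) c y → β (fullG G) K (d (fullG G) c) y ≡ d K (β (fullG G) K c) y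
  β-commutes-with-d K c y = begin
    β (fullG G) K (d (fullG G) c) y
      ≡⟨ β-full K (d (fullG G) c) y ⟩
    (if validᵇ K y then d (fullG G) c y else 0ℤ)
      ≡⟨ if-∑ (validᵇ K y) (basis (fullG G)) _ ⟩
    ∑ (basis (fullG G)) (λ b → if validᵇ K y then c b * dCoeff (fullG G) b y else 0ℤ)
      ≡⟨ ∑-basis-cong (fullG G) termwise ⟩
    ∑ (basis (fullG G)) (λ b → if validᵇ K b then βc b * dCoeff K b y else 0ℤ)
      ≡⟨ sym (∑-basis-restrict K (λ b → βc b * dCoeff K b y)) ⟩
    ∑ (basis K) (λ b → βc b * dCoeff K b y)
      ≡⟨ ∑-cong (basis K) (λ b → cong (_* dCoeff K b y) (sym (β-full K c b))) ⟩
    d K (β (fullG G) K c) y ∎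
    where
    open ≡-Reasoning
    βc : Idx G → ℤ
    βc b = if validᵇ K b then c b else 0ℤ
    termwise : ∀ b → validᵇ (fullG G) b ≡ true →
      (if validᵇ K y then c b * dCoeff (fullG G) b y else 0ℤ) ≡ (if validᵇ K b then βc b * dCoeff K b y else 0ℤ)
    termwise b@(s , X , w) b-valid with withinᵇ K b in b∈K
    ... | true  rewrite validᵇ-split K b | b-valid | b∈K =
      trans (*-if (validᵇ K y) (c b) _) (cong (c b *_) (dCoeff-restrict K s X w y b-valid b∈K))
    ... | false rewrite validᵇ-split K b | b-valid | b∈K with validᵇ K y in y-valid
    ...   | false = refl
    ...   | true  = trans (cong (c b *_) (dCoeff-outside (fullG G) K s X w y y∈K b∈K)) (ℤₚ.*-zeroʳ (c b))
      where
      y∈K : withinᵇ K y ≡ true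
      y∈K = valid⇒within K y y-valid

  -- Degrees, cohomology and naturality

  β-full-support : ∀ (K : SubG G) c y →
                   (β (fullG G) K c y ≡ 0ℤ) ⊎ ((validᵇ K y ≡ true) × (β (fullG G) K c y ≡ c y))
  β-full-support K c y with validᵇ K y in y-valid
  ... | true  = inj₂ (refl , trans (β-full K c y) (if-true _ y-valid))
  ... | false = inj₁ (trans (β-full K c y) (if-false _ y-valid))

  ncompIn-sub : ∀ (K : SubG G) s X → lookup X ⊑ lookup (VS K) → ncompIn K s X ≡ ncompIn (fullG G) s X
  ncompIn-sub K s X X⊑V = count-cong (allFin (nv G)) (λ v → marked-in-K v (lookup X v) refl)
    where
    marked-in-K : ∀ v x → lookup X v ≡ x →
                  lookup (VS K) v ∧ (isRep G s v ∧ x) ≡ lookup ⊤ v ∧ (isRep G s v ∧ x)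
    marked-in-K v false _
      rewrite ∧-zeroʳ (isRep G s v) | ∧-zeroʳ (lookup (VS K) v) | ∧-zeroʳ (lookup (⊤ {nv G}) v) = refl
    marked-in-K v true  x∈X rewrite X⊑V v x∈X | lookup-⊤ {nv G} v = refl

  β-preserves-InCdeg : ∀ (K : SubG G) i j k c → InCdeg (fullG G) i j k c → InCdeg K i j k (β (fullG G) K c)
  β-preserves-InCdeg K i j k c homogeneous y@(s , X , w) with β-full-support K c y | homogeneous y
  ... | inj₁ vanishes         | _                      = inj₁ vanishes
  ... | inj₂ (_ , βc≡c)       | inj₁ c≡0               = inj₁ (trans βc≡c c≡0)
  ... | inj₂ (y-valid , _)    | inj₂ (_ , deg≡)        = inj₂ (y-valid ,
    trans (cong (λ n → ∣ s ∣ , n , countTrue w) (ncompIn-sub K s X X⊑V)) deg≡)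
    where
    X⊑V : lookup X ⊑ lookup (VS K)
    X⊑V = proj₂ (within⁻ K s X w (valid⇒within K y y-valid))

  β-preserves-InCi : ∀ (K : SubG G) i c → InCi (fullG G) i c → InCi K i (β (fullG G) K c)
  β-preserves-InCi K i c homogeneous y with β-full-support K c y | homogeneous y
  ... | inj₁ vanishes      | _               = inj₁ vanishes
  ... | inj₂ (_ , βc≡c)    | inj₁ c≡0        = inj₁ (trans βc≡c c≡0)
  ... | inj₂ (y-valid , _) | inj₂ (_ , ∣s∣≡i) = inj₂ (y-valid , ∣s∣≡i)

  Vanishes : Chain G → Set
  Vanishes c = ∀ y → c y ≡ 0ℤ

  β-cong : ∀ (K : SubG G) c c′ → (∀ y → c y ≡ c′ y) → ∀ y → β (fullG G) K c y ≡ β (fullG G) K c′ y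
  β-cong K c c′ c≗c′ y =
    trans (β-full K c y) (trans (cong (λ t → if validᵇ K y then t else 0ℤ) (c≗c′ y)) (sym (β-full K c′ y)))

  β-zero : ∀ (K : SubG G) c → Vanishes c → Vanishes (β (fullG G) K c)
  β-zero K c c=0 y = trans (β-full K c y) (if-0 (validᵇ K y) (c=0 y))

  β-preserves-Cocycle : ∀ (K : SubG G) i z → Cocycle (fullG G) i z → Cocycle K i (β (fullG G) K z)
  β-preserves-Cocycle K i z (z∈Ci , dz≈0) =
    β-preserves-InCi K i z z∈Ci , λ y → trans (sym (β-commutes-with-d K z y)) (β-zero K _ dz≈0 y)

  β-preserves-Coboundary : ∀ (K : SubG G) i z → Coboundary (fullG G) i z → Coboundary K i (β (fullG G) K z)
  β-preserves-Coboundary K zero    z z≈0 = β-zero K z z≈0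
  β-preserves-Coboundary K (suc i) z (x , x∈Ci , z≈dx) = β (fullG G) K x , β-preserves-InCi K i x x∈Ci ,
    λ y → trans (β-cong K z (d (fullG G) x) z≈dx y) (β-commutes-with-d K x y)

  d-zero : ∀ (H : SubG G) → Vanishes (d H (zeroC {G = G}))
  d-zero H y = ∑-zero (basis H) (λ b → ℤₚ.*-zeroˡ (∑ (dBasis H b) (coeff y)))

  Vanishes⇒Coboundary : ∀ (H : SubG G) i z → Vanishes z → Coboundary H i z
  Vanishes⇒Coboundary H zero    z z=0 = z=0
  Vanishes⇒Coboundary H (suc i) z z=0 = zeroC {G = G} , (λ _ → inj₁ refl) , λ y → trans (z=0 y) (sym (d-zero H y))

  ≤G⇒within : ∀ (K L : SubG G) → L ≤G K → ∀ y → withinᵇ L y ≡ true → withinᵇ K y ≡ true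
  ≤G⇒within K L (V⊑ , E⊑) (s , X , w) y∈L = let (s⊑E , X⊑V) = within⁻ L s X w y∈L in
    within⁺ K s X w (λ e h → E⊑ e (s⊑E e h)) (λ v h → V⊑ v (X⊑V v h))

  β-∘ : ∀ (H K L : SubG G) → L ≤G K → ∀ c y → β K L (β H K c) y ≡ β H L c y
  β-∘ H K L L≤K c y
    rewrite β-apply K L (β H K c) y | β-apply H K c y | β-apply H L c y
          | validᵇ-split K y | validᵇ-split H y =
    nested (validᵇ (fullG G) y) (withinᵇ H y) (withinᵇ K y) (withinᵇ L y) (c y) (≤G⇒within K L L≤K y)
    where
    nested : ∀ f h k l (x : ℤ) → (l ≡ true → k ≡ true) →
      (if (f ∧ k) ∧ l then (if (f ∧ h) ∧ k then x else 0ℤ) else 0ℤ) ≡ (if (f ∧ h) ∧ l then x else 0ℤ)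
    nested false _     _     _     x _ = refl
    nested true  true  true  l     x _ = refl
    nested true  false true  true  x _ = refl
    nested true  false true  false x _ = refl
    nested true  h     false true  x l⇒k = ⊥-elim (true≢false (sym (l⇒k refl)))
    nested true  true  false false x _ = refl
    nested true  false false false x _ = refl

theorem6p6 :
  (G : Graph) →
  ((K : SubG G) →
    -- (1) β : C(G) → C(K) is a chain map ...
    ((c : Chain G) → InC (fullG G) c →
       _≈_ {G = G} (β (fullG G) K (d (fullG G) c)) (d K (β (fullG G) K c))) ×
    -- ... which preserves the degree (i , j , k) ...
    ((i j k : ℕ) (c : Chain G) → InCdeg (fullG G) i j k c →
       InCdeg K i j k (β (fullG G) K c)) ×
    -- (2) ... hence induces β* : H^i(G) → H^i(K): cocycles go to cocycles
    -- and coboundaries to coboundaries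
    ((i : ℕ) (z : Chain G) → Cocycle (fullG G) i z →
       Cocycle K i (β (fullG G) K z)) ×
    ((i : ℕ) (z : Chain G) → InCi (fullG G) i z → Coboundary (fullG G) i z →
       Coboundary K i (β (fullG G) K z))) ×
  -- (3) naturality: for L ⊆ K ⊆ G, β* = β₁* ∘ β₂* on H^i(G)
  ((K L : SubG G) → L ≤G K → (i : ℕ) (z : Chain G) → Cocycle (fullG G) i z →
     Coboundary L i (_-C_ {G = G} (β (fullG G) L z) (β K L (β (fullG G) K z))))
theorem6p6 G =
  (λ K → (λ c _ → β-commutes-with-d G K c)
       , β-preserves-InCdeg G K
       , β-preserves-Cocycle G K
       , (λ i z _ → β-preserves-Coboundary G K i z))
  , λ K L L≤K i z _ → Vanishes⇒Coboundary G L i _ λ y →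
      trans (cong (β (fullG G) L z y -_) (β-∘ G (fullG G) K L L≤K z y)) (ℤₚ.+-inverseʳ (β (fullG G) L z y))
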